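{- Let $k\ge 2$ and $n\ge k+4$ be integers, and let $\mathcal{S}_{n,k}$ be the set of $n$-vertex simple $k$-paths, up to isomorphism. Then $|\mathcal{S}_{n,k}|\ge k^{n-2k-2}$.
   Context: A graph $G$ is a simple $k$-path if it has a path-decomposition $(X_1,\dots,X_m)$ (a sequence of vertex subsets covering $V(G)$, such that each edge lies in some $X_i$ and for each vertex the indices of bags containing it form an interval) such that: $|X_i|=k+1$ for all $i\in[m]$; $|X_i\cap X_{i+1}|=k$ for all $i\in[m-1]$; the sets $X_i\cap X_{i+1}$, $i\in[m-1]$, are pairwise distinct; and $G[X_i]$ is a clique for every $i\in[m]$ (and every edge of $G$ lies in some $X_i$). -}

module Defs where

open import Data.Nat using (ℕ; suc; _+_; _<_; _≤_)
open import Data.Fin using (Fin)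
open import Data.Fin.Subset using (Subset; _∈_; _∩_; ∣_∣)
open import Data.Fin.Permutation using (Permutation′; _⟨$⟩ʳ_)
open import Data.Bool using (Bool; true; false)
open import Data.Product using (Σ; ∃; _×_)
open import Relation.Binary.PropositionalEquality using (_≡_; _≢_)

record Graph (n : ℕ) : Set where
  field
    adj   : Fin n → Fin n → Bool
    sym   : ∀ u v → adj u v ≡ adj v u
    irrefl : ∀ v → adj v v ≡ false
open Graph public

Edge : ∀ {n} → Graph n → Fin n → Fin n → Set
Edge G u v = adj G u v ≡ true

Iso : ∀ {n} → Graph n → Graph n → Set
Iso {n} G H = Σ (Permutation′ n) λ π →
  ∀ u v → adj G u v ≡ adj H (π ⟨$⟩ʳ u) (π ⟨$⟩ʳ v)

IsPathDecomposition : ∀ {n} → Graph n → (m : ℕ) → (ℕ → Subset n) → Set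
IsPathDecomposition {n} G m X =
  (∀ (v : Fin n) → ∃ λ i → i < m × v ∈ X i)
  × (∀ u v → Edge G u v → ∃ λ i → i < m × u ∈ X i × v ∈ X i)
  × (∀ (v : Fin n) i j l → i ≤ j → j ≤ l → l < m → v ∈ X i → v ∈ X l → v ∈ X j)

IsSimpleKPath : ∀ {n} → ℕ → Graph n → Set
IsSimpleKPath {n} k G = ∃ λ (m : ℕ) → ∃ λ (X : ℕ → Subset n) →
  IsPathDecomposition G m X
  × (∀ i → i < m → ∣ X i ∣ ≡ suc k)
  × (∀ i → suc i < m → ∣ X i ∩ X (suc i) ∣ ≡ k)
  × (∀ i j → suc i < m → suc j < m → i ≢ j → X i ∩ X (suc i) ≢ X j ∩ X (suc j))
  × (∀ i → i < m → ∀ u v → u ∈ X i → v ∈ X i → u ≢ v → Edge G u v)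

module Submission where

-- A simple k-path is grown from a clique on the vertices 0, …, k, vertex u sitting in
-- slot u: at time t = 1, …, M the new vertex k + t takes slot a t and evicts its
-- occupant, and two vertices are adjacent iff they are ever present together.  When
-- consecutive slots differ, the sets present at the times 0, …, M are the bags of a
-- path decomposition witnessing a simple k-path on k + M + 1 vertices.
--
-- These graphs are rigid.  Their only simplicial vertices are the first vertex to be
-- evicted and the last one born, so an isomorphism maps the first bag onto the first
-- bag or, after reversing the slot sequence, onto the last one; by induction along
-- the path it then maps every newborn to the corresponding newborn.  Hence the slot
-- sequences of isomorphic graphs agree up to a relabelling of the slots and possibly
-- a reversal.
--
-- For k ≥ 3 a prefix 0, 1, …, k − 1 forces the relabelling to be the identity and a
-- final step back to the slot used two steps earlier rules out reversal, so the
-- L = n − 2k − 2 free moves, each to one of the k slots other than the current one,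
-- give k ^ L pairwise non-isomorphic graphs.  For k = 2 each move is a binary choice
-- (return to the slot left one step earlier, or not), which a relabelling preserves;
-- the choices spell the code of an L-bit word under an injective code no value of
-- which is the reversal of another.  For n < 2k + 2 the bound is 1.

open import Defs using (Graph; Edge; Iso; IsSimpleKPath)
open import Data.Bool using (Bool; true; false; _∧_; not; if_then_else_; T)
open import Data.Empty using (⊥-elim)
open import Data.Fin as Fin using (Fin; zero; suc; toℕ; fromℕ<; punchIn; finToFun; funToFin)
open import Data.Fin.Patterns using (0F; 1F; 2F)
open import Data.Fin.Permutation using (Permutation′; _⟨$⟩ʳ_; _⟨$⟩ˡ_; inverseˡ; inverseʳ)
import Data.Fin.Properties as Finₚ
open import Data.Fin.Properties
  using (toℕ-injective; toℕ≤pred[n]; toℕ<n; toℕ-fromℕ<; fromℕ<-toℕ; funToFin-finToFin;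
         punchIn-injective; punchInᵢ≢i; 2↔Bool)
open import Data.Fin.Subset using (Subset; _∈_; _∩_; ∣_∣)
open import Data.List as List using (List; length; []; _∷_)
open import Data.List.Properties using (length-tabulate)
open import Data.List.Relation.Unary.All using (All; []; _∷_)
import Data.List.Relation.Unary.All.Properties as All
open import Data.List.Relation.Unary.AllPairs using (AllPairs; []; _∷_)
import Data.List.Relation.Unary.AllPairs.Properties as AllPairs
open import Data.Nat as ℕ using (ℕ; zero; suc; _+_; _*_; _∸_; _^_; _≤_; _<_; _<ᵇ_; _≤?_; z≤n; s≤s; s≤s⁻¹)
open import Data.Nat.Properties
open import Data.Nat.Tactic.RingSolver using (solve-∀)
open import Data.Product using (∃; _×_; _,_; proj₁; proj₂)
open import Data.Sum using (_⊎_; inj₁; inj₂)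
open import Data.Vec as Vec using (Vec; []; _∷_; _∷ʳ_; lookup; tabulate; reverse)
open import Data.Vec.Properties
  using (lookup∘tabulate; tabulate∘lookup; tabulate-cong; lookup-zipWith; []=⇒lookup; lookup⇒[]=; reverse-∷;
         ∷-injective; ∷-injectiveˡ; ∷-injectiveʳ; ∷ʳ-injectiveˡ; ∷ʳ-injectiveʳ)
open import Function using (_∘_; id; _⇔_; mk⇔; Equivalence; Injective; Inverse)
open import Relation.Binary.Definitions using (tri<; tri≈; tri>)
open import Relation.Binary.PropositionalEquality
open import Relation.Nullary using (¬_; Dec; yes; no; does; ¬?; _×-dec_)
open import Relation.Nullary.Decidable using (dec-true; dec-false; does-⇔; map′; decidable-stable; T?)

clamp : (k u : ℕ) → Fin (suc k)
clamp zero    _       = zero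
clamp (suc k) zero    = zero
clamp (suc k) (suc u) = suc (clamp k u)

toℕ-clamp : ∀ k u → u ≤ k → toℕ (clamp k u) ≡ u
toℕ-clamp zero    zero    _         = refl
toℕ-clamp (suc k) zero    _         = refl
toℕ-clamp (suc k) (suc u) (s≤s u≤k) = cong suc (toℕ-clamp k u u≤k)

clamp-toℕ : ∀ k (c : Fin (suc k)) → clamp k (toℕ c) ≡ c
clamp-toℕ k c = toℕ-injective (toℕ-clamp k (toℕ c) (toℕ≤pred[n] c))

≤⊎≡+suc : ∀ k u → u ≤ k ⊎ ∃ λ j → u ≡ k + suc j
≤⊎≡+suc zero    zero    = inj₁ z≤n
≤⊎≡+suc zero    (suc u) = inj₂ (u , refl)
≤⊎≡+suc (suc k) zero    = inj₁ z≤n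
≤⊎≡+suc (suc k) (suc u) with ≤⊎≡+suc k u
... | inj₁ u≤k       = inj₁ (s≤s u≤k)
... | inj₂ (j , u≡) = inj₂ (j , cong suc u≡)

≤-suc-cases : ∀ {j l} → j ≤ suc l → j ≡ suc l ⊎ j ≤ l
≤-suc-cases j≤1+l with m≤n⇒m<n∨m≡n j≤1+l
... | inj₁ j<1+l = inj₂ (s≤s⁻¹ j<1+l)
... | inj₂ j≡1+l = inj₁ j≡1+l

does⇒ : ∀ {A : Set} (a? : Dec A) → does a? ≡ true → A
does⇒ (yes a) _ = a

k+1+t≰k+t : ∀ k t → ¬ k + suc t ≤ k + t
k+1+t≰k+t k t = <⇒≱ (+-monoʳ-< k ≤-refl)

+-∸-mirror : ∀ c {L d} → d ≤ L → c + L ∸ (L ∸ d) ≡ c + d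
+-∸-mirror c {L} {d} d≤L = trans (+-∸-assoc c (m∸n≤m L d)) (cong (c +_) (m∸[m∸n]≡n d≤L))

does-≡⇒⇔ : ∀ {A B : Set} (a? : Dec A) (b? : Dec B) → does a? ≡ does b? → A ⇔ B
does-≡⇒⇔ a? b? e = mk⇔ (λ x → does⇒ b? (trans (sym e) (dec-true a? x)))
                       (λ y → does⇒ a? (trans e (dec-true b? y)))

lookup-ext : ∀ {A : Set} {N} (xs ys : Vec A N) → (∀ i → lookup xs i ≡ lookup ys i) → xs ≡ ys
lookup-ext xs ys same = begin
  xs                   ≡⟨ tabulate∘lookup xs ⟨
  tabulate (lookup xs) ≡⟨ tabulate-cong same ⟩
  tabulate (lookup ys) ≡⟨ tabulate∘lookup ys ⟩
  ys                   ∎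
  where open ≡-Reasoning

∣p∣≡1+∣q∣ : ∀ {N} (p q : Subset N) i → lookup p i ≡ true → lookup q i ≡ false →
            (∀ j → j ≢ i → lookup p j ≡ lookup q j) → ∣ p ∣ ≡ suc ∣ q ∣
∣p∣≡1+∣q∣ (true ∷ p) (false ∷ q) zero refl refl same =
  cong (suc ∘ ∣_∣) (lookup-ext p q (λ j → same (suc j) λ ()))
∣p∣≡1+∣q∣ (x ∷ p) (y ∷ q) (suc i) p-i q-i same
  with same zero (λ ()) | ∣p∣≡1+∣q∣ p q i p-i q-i (λ j j≢i → same (suc j) (j≢i ∘ Finₚ.suc-injective))
... | refl | tail with x
...   | true  = cong suc tail
...   | false = tail

∣tabulate-<ᵇ∣ : ∀ {N} j → j ≤ N → ∣ tabulate {n = N} (λ i → toℕ i <ᵇ j) ∣ ≡ j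
∣tabulate-<ᵇ∣ {zero}  zero    _         = refl
∣tabulate-<ᵇ∣ {suc N} zero    _         = ∣tabulate-<ᵇ∣ {N} zero z≤n
∣tabulate-<ᵇ∣ {suc N} (suc j) (s≤s j≤N) = cong suc (∣tabulate-<ᵇ∣ {N} j j≤N)

-- Slot sequences and slot graphs

module Slots (k : ℕ) (a : ℕ → Fin (suc k)) where

  -- The value a 0 is never used.
  occupant : Fin (suc k) → ℕ → ℕ
  occupant c zero = toℕ c
  occupant c (suc t) with a (suc t) Fin.≟ c
  ... | yes _ = k + suc t
  ... | no  _ = occupant c t

  occupant-replaced : ∀ c t → a (suc t) ≡ c → occupant c (suc t) ≡ k + suc t
  occupant-replaced c t e with a (suc t) Fin.≟ c
  ... | yes _ = refl
  ... | no ne = ⊥-elim (ne e)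

  occupant-kept : ∀ c t → a (suc t) ≢ c → occupant c (suc t) ≡ occupant c t
  occupant-kept c t ne with a (suc t) Fin.≟ c
  ... | yes e = ⊥-elim (ne e)
  ... | no _  = refl

  occupant≤ : ∀ c t → occupant c t ≤ k + t
  occupant≤ c zero = ≤-trans (toℕ≤pred[n] c) (m≤m+n k 0)
  occupant≤ c (suc t) with a (suc t) Fin.≟ c
  ... | yes _ = ≤-refl
  ... | no  _ = ≤-trans (occupant≤ c t) (+-monoʳ-≤ k (n≤1+n t))

  birth : ℕ → ℕ
  birth u = u ∸ k

  private
    slotBornAt : ℕ → ℕ → Fin (suc k)
    slotBornAt zero    u = clamp k u
    slotBornAt (suc t) _ = a (suc t)

  slot : ℕ → Fin (suc k)
  slot u = slotBornAt (birth u) u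

  slot-initial : ∀ u → u ≤ k → slot u ≡ clamp k u
  slot-initial u u≤k rewrite m≤n⇒m∸n≡0 u≤k = refl

  toℕ-slot-initial : ∀ u → u ≤ k → toℕ (slot u) ≡ u
  toℕ-slot-initial u u≤k rewrite slot-initial u u≤k = toℕ-clamp k u u≤k

  slot-toℕ : ∀ c → slot (toℕ c) ≡ c
  slot-toℕ c rewrite slot-initial (toℕ c) (toℕ≤pred[n] c) = clamp-toℕ k c

  slot-newborn : ∀ t → slot (k + suc t) ≡ a (suc t)
  slot-newborn t rewrite m+n∸m≡n k (suc t) = refl

  slot-occupant : ∀ c t → slot (occupant c t) ≡ c
  slot-occupant c zero = slot-toℕ c
  slot-occupant c (suc t) with a (suc t) Fin.≟ c
  ... | yes e = trans (slot-newborn t) e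
  ... | no  _ = slot-occupant c t

  Alive : ℕ → ℕ → Set
  Alive u t = occupant (slot u) t ≡ u

  alive? : ∀ u t → Dec (Alive u t)
  alive? u t = occupant (slot u) t ℕ.≟ u

  alive-occupant : ∀ c t → Alive (occupant c t) t
  alive-occupant c t rewrite slot-occupant c t = refl

  alive⇒≤ : ∀ {u t} → Alive u t → u ≤ k + t
  alive⇒≤ {u} {t} alive = subst (_≤ k + t) alive (occupant≤ (slot u) t)

  alive-newborn : ∀ t → Alive (k + suc t) (suc t)
  alive-newborn t rewrite slot-newborn t = occupant-replaced (a (suc t)) t refl

  alive-birth : ∀ u → Alive u (birth u)
  alive-birth u with ≤⊎≡+suc k u
  ... | inj₁ u≤k       = subst (Alive u) (sym (m≤n⇒m∸n≡0 u≤k)) (toℕ-slot-initial u u≤k)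
  ... | inj₂ (j , refl) = subst (Alive (k + suc j)) (sym (m+n∸m≡n k (suc j))) (alive-newborn j)

  unborn : ∀ t → ¬ Alive (k + suc t) t
  unborn t alive = k+1+t≰k+t k t (alive⇒≤ alive)

  alive-suc : ∀ {u t} → Alive u t → a (suc t) ≢ slot u → Alive u (suc t)
  alive-suc {u} {t} alive ne = trans (occupant-kept (slot u) t ne) alive

  alive-suc⁻ : ∀ {u t} → Alive u (suc t) → u ≡ k + suc t ⊎ Alive u t
  alive-suc⁻ {u} {t} alive with a (suc t) Fin.≟ slot u
  ... | yes _ = inj₁ (sym alive)
  ... | no  _ = inj₂ alive

  death-slot : ∀ {u t} → Alive u t → ¬ Alive u (suc t) → a (suc t) ≡ slot u
  death-slot {u} {t} alive dead =
    decidable-stable (a (suc t) Fin.≟ slot u) (dead ∘ alive-suc alive)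

  replaced-dies : ∀ t → ¬ Alive (occupant (a (suc t)) t) (suc t)
  replaced-dies t alive = k+1+t≰k+t k t (subst (_≤ k + t) newborn≡ (occupant≤ (a (suc t)) t))
    where
    newborn≡ : occupant (a (suc t)) t ≡ k + suc t
    newborn≡ = begin
      occupant (a (suc t)) t                           ≡⟨ alive ⟨
      occupant (slot (occupant (a (suc t)) t)) (suc t) ≡⟨ cong (λ c → occupant c (suc t)) (slot-occupant (a (suc t)) t) ⟩
      occupant (a (suc t)) (suc t)                     ≡⟨ occupant-replaced (a (suc t)) t refl ⟩
      k + suc t                                        ∎
      where open ≡-Reasoning

  alive-downward : ∀ {u j} l → Alive u l → j ≤ l → u ≤ k + j → Alive u j
  alive-downward zero    alive z≤n _ = alive
  alive-downward (suc l) alive j≤l u≤ with ≤-suc-cases j≤l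
  ... | inj₁ refl = alive
  ... | inj₂ j≤l′ with alive-suc⁻ alive
  ...   | inj₁ refl   = ⊥-elim (k+1+t≰k+t k l (≤-trans u≤ (+-monoʳ-≤ k j≤l′)))
  ...   | inj₂ alive′ = alive-downward l alive′ j≤l′ u≤

  alive-interval : ∀ {u i j l} → Alive u i → Alive u l → i ≤ j → j ≤ l → Alive u j
  alive-interval {l = l} alive-i alive-l i≤j j≤l =
    alive-downward l alive-l j≤l (≤-trans (alive⇒≤ alive-i) (+-monoʳ-≤ k i≤j))

module SlotGraph (k M : ℕ) (a : ℕ → Fin (suc k)) where
  open Slots k a public

  Adjacent : ℕ → ℕ → Set
  Adjacent u v = u ≢ v × ∃ λ t → t ≤ M × Alive u t × Alive v t

  adjacent? : ∀ u v → Dec (Adjacent u v)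
  adjacent? u v = ¬? (u ℕ.≟ v) ×-dec map′
    (λ (t , t<1+M , both) → t , s≤s⁻¹ t<1+M , both)
    (λ (t , t≤M , both) → t , s≤s t≤M , both)
    (anyUpTo? (λ t → alive? u t ×-dec alive? v t) (suc M))

  Adjacent-sym : ∀ {u v} → Adjacent u v → Adjacent v u
  Adjacent-sym (u≢v , t , t≤M , alive-u , alive-v) = u≢v ∘ sym , t , t≤M , alive-v , alive-u

  dead⇒¬Adjacent-younger : ∀ {u w t} → Alive u t → ¬ Alive u (suc t) → k + suc t ≤ w → ¬ Adjacent u w
  dead⇒¬Adjacent-younger {t = t} alive dead k+1+t≤w (_ , τ , _ , alive-u , alive-w) =
    dead (alive-interval alive alive-u (n≤1+n t)
      (+-cancelˡ-≤ k (suc t) τ (≤-trans k+1+t≤w (alive⇒≤ alive-w))))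

  replaced-¬Adjacent-newborn : ∀ t → ¬ Adjacent (occupant (a (suc t)) t) (k + suc t)
  replaced-¬Adjacent-newborn t = dead⇒¬Adjacent-younger (alive-occupant (a (suc t)) t) (replaced-dies t) ≤-refl

  ¬Adjacent-newborn⇒replaced : ∀ {c t} → t < M → ¬ Adjacent (occupant c t) (k + suc t) → a (suc t) ≡ c
  ¬Adjacent-newborn⇒replaced {c} {t} t<M ¬adjacent =
    trans (death-slot (alive-occupant c t) dies) (slot-occupant c t)
    where
    dies : ¬ Alive (occupant c t) (suc t)
    dies alive = ¬adjacent
      ( (λ e → k+1+t≰k+t k t (subst (_≤ k + t) e (occupant≤ c t)))
      , suc t , t<M , alive , alive-newborn t)

  slotGraph : Graph (suc (k + M))
  slotGraph = record
    { adj    = λ i j → does (adjacent? (toℕ i) (toℕ j))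
    ; sym    = λ i j → does-⇔ (mk⇔ Adjacent-sym Adjacent-sym)
                                 (adjacent? (toℕ i) (toℕ j)) (adjacent? (toℕ j) (toℕ i))
    ; irrefl = λ i → dec-false (adjacent? (toℕ i) (toℕ i)) (λ (i≢i , _) → i≢i refl)
    }

  birth≤ : ∀ {u} → u ≤ k + M → birth u ≤ M
  birth≤ {u} u≤k+M = subst (birth u ≤_) (m+n∸m≡n k M) (∸-monoˡ-≤ k u≤k+M)

  vertex : ∀ u → u ≤ k + M → Fin (suc (k + M))
  vertex u u≤k+M = fromℕ< (s≤s u≤k+M)

  toℕ-vertex : ∀ {u} (u≤k+M : u ≤ k + M) → toℕ (vertex u u≤k+M) ≡ u
  toℕ-vertex u≤k+M = toℕ-fromℕ< (s≤s u≤k+M)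

  ConsecutiveDistinct : Set
  ConsecutiveDistinct = ∀ t → 1 ≤ t → t < M → a (suc t) ≢ a t

module SlotKPath (k M : ℕ) (a : ℕ → Fin (suc k)) where
  open SlotGraph k M a

  n : ℕ
  n = suc (k + M)

  bag : ℕ → Subset n
  bag t = tabulate (λ i → does (alive? (toℕ i) t))

  separator : ℕ → Subset n
  separator t = bag t ∩ bag (suc t)

  lookup-bag : ∀ t i → lookup (bag t) i ≡ does (alive? (toℕ i) t)
  lookup-bag t = lookup∘tabulate _

  lookup-separator : ∀ t i → lookup (separator t) i ≡ does (alive? (toℕ i) t ×-dec alive? (toℕ i) (suc t))
  lookup-separator t i =
    trans (lookup-zipWith _∧_ i (bag t) (bag (suc t))) (cong₂ _∧_ (lookup-bag t i) (lookup-bag (suc t) i))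

  alive⇒∈bag : ∀ {i} t → Alive (toℕ i) t → i ∈ bag t
  alive⇒∈bag {i} t alive = lookup⇒[]= i (bag t) (trans (lookup-bag t i) (dec-true (alive? (toℕ i) t) alive))

  ∈bag⇒alive : ∀ {i} t → i ∈ bag t → Alive (toℕ i) t
  ∈bag⇒alive {i} t i∈bag = does⇒ (alive? (toℕ i) t) (trans (sym (lookup-bag t i)) ([]=⇒lookup i∈bag))

  ∣bag∣≡1+∣separator∣ : ∀ t → t < M → ∣ bag t ∣ ≡ suc ∣ separator t ∣
  ∣bag∣≡1+∣separator∣ t t<M = ∣p∣≡1+∣q∣ (bag t) (separator t) (vertex d d≤) in-bag not-in-sep same
    where
    d = occupant (a (suc t)) t
    d≤ : d ≤ k + M
    d≤ = ≤-trans (occupant≤ (a (suc t)) t) (+-monoʳ-≤ k (<⇒≤ t<M))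
    in-bag : lookup (bag t) (vertex d d≤) ≡ true
    in-bag rewrite lookup-bag t (vertex d d≤) | toℕ-vertex d≤ = dec-true (alive? d t) (alive-occupant _ t)
    not-in-sep : lookup (separator t) (vertex d d≤) ≡ false
    not-in-sep rewrite lookup-separator t (vertex d d≤) | toℕ-vertex d≤ =
      dec-false (alive? d t ×-dec alive? d (suc t)) (replaced-dies t ∘ proj₂)
    survives : ∀ j → j ≢ vertex d d≤ → Alive (toℕ j) t → Alive (toℕ j) (suc t)
    survives j j≢d alive = alive-suc alive λ replaced → j≢d (toℕ-injective (begin
      toℕ j                           ≡⟨ alive ⟨
      occupant (slot (toℕ j)) t       ≡⟨ cong (λ c → occupant c t) replaced ⟨
      d                               ≡⟨ toℕ-vertex d≤ ⟨
      toℕ (vertex d d≤)               ∎))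
      where open ≡-Reasoning
    same : ∀ j → j ≢ vertex d d≤ → lookup (bag t) j ≡ lookup (separator t) j
    same j j≢d rewrite lookup-bag t j | lookup-separator t j =
      does-⇔ (mk⇔ (λ alive → alive , survives j j≢d alive) proj₁)
             (alive? (toℕ j) t) (alive? (toℕ j) t ×-dec alive? (toℕ j) (suc t))

  ∣bag-suc∣≡1+∣separator∣ : ∀ t → t < M → ∣ bag (suc t) ∣ ≡ suc ∣ separator t ∣
  ∣bag-suc∣≡1+∣separator∣ t t<M =
    ∣p∣≡1+∣q∣ (bag (suc t)) (separator t) (vertex z z≤) in-bag not-in-sep same
    where
    z = k + suc t
    z≤ : z ≤ k + M
    z≤ = +-monoʳ-≤ k t<M
    in-bag : lookup (bag (suc t)) (vertex z z≤) ≡ true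
    in-bag rewrite lookup-bag (suc t) (vertex z z≤) | toℕ-vertex z≤ = dec-true (alive? z (suc t)) (alive-newborn t)
    not-in-sep : lookup (separator t) (vertex z z≤) ≡ false
    not-in-sep rewrite lookup-separator t (vertex z z≤) | toℕ-vertex z≤ =
      dec-false (alive? z t ×-dec alive? z (suc t)) (unborn t ∘ proj₁)
    older : ∀ j → j ≢ vertex z z≤ → Alive (toℕ j) (suc t) → Alive (toℕ j) t
    older j j≢z alive with alive-suc⁻ alive
    ... | inj₁ j≡z   = ⊥-elim (j≢z (toℕ-injective (trans j≡z (sym (toℕ-vertex z≤)))))
    ... | inj₂ alive′ = alive′
    same : ∀ j → j ≢ vertex z z≤ → lookup (bag (suc t)) j ≡ lookup (separator t) j
    same j j≢z rewrite lookup-bag (suc t) j | lookup-separator t j =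
      does-⇔ (mk⇔ (λ alive → older j j≢z alive , alive) proj₂)
             (alive? (toℕ j) (suc t)) (alive? (toℕ j) t ×-dec alive? (toℕ j) (suc t))

  alive₀⇔ : ∀ u → Alive u 0 ⇔ T (u <ᵇ suc k)
  alive₀⇔ u = mk⇔ (λ alive → <⇒<ᵇ (s≤s (subst (u ≤_) (+-identityʳ k) (alive⇒≤ alive))))
                  (λ u<1+k → toℕ-slot-initial u (s≤s⁻¹ (<ᵇ⇒< u (suc k) u<1+k)))

  ∣bag₀∣ : ∣ bag 0 ∣ ≡ suc k
  ∣bag₀∣ = trans
    (cong ∣_∣ (tabulate-cong {n = n} λ i → does-⇔ (alive₀⇔ (toℕ i)) (alive? (toℕ i) 0) (T? _)))
    (∣tabulate-<ᵇ∣ (suc k) (s≤s (m≤m+n k M)))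

  ∣bag∣ : ∀ t → t ≤ M → ∣ bag t ∣ ≡ suc k
  ∣bag∣ zero    _     = ∣bag₀∣
  ∣bag∣ (suc t) t<M = begin
    ∣ bag (suc t) ∣          ≡⟨ ∣bag-suc∣≡1+∣separator∣ t t<M ⟩
    suc ∣ separator t ∣      ≡⟨ ∣bag∣≡1+∣separator∣ t t<M ⟨
    ∣ bag t ∣                ≡⟨ ∣bag∣ t (<⇒≤ t<M) ⟩
    suc k                    ∎
    where open ≡-Reasoning

  ∣separator∣ : ∀ t → t < M → ∣ separator t ∣ ≡ k
  ∣separator∣ t t<M = suc-injective (trans (sym (∣bag∣≡1+∣separator∣ t t<M)) (∣bag∣ t (<⇒≤ t<M)))

  newborn∉separator : ∀ {i j} (z≤ : k + suc j ≤ k + M) → i ≤ j →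
                      lookup (separator i) (vertex (k + suc j) z≤) ≡ false
  newborn∉separator {i} {j} z≤ i≤j rewrite lookup-separator i (vertex (k + suc j) z≤) | toℕ-vertex z≤ =
    dec-false (alive? (k + suc j) i ×-dec alive? (k + suc j) (suc i))
              (λ (alive , _) → k+1+t≰k+t k j (≤-trans (alive⇒≤ alive) (+-monoʳ-≤ k i≤j)))

  newborn∈separator : ConsecutiveDistinct → ∀ {j} (z≤ : k + suc j ≤ k + M) → suc j < M →
                      lookup (separator (suc j)) (vertex (k + suc j) z≤) ≡ true
  newborn∈separator distinct {j} z≤ 1+j<M
    rewrite lookup-separator (suc j) (vertex (k + suc j) z≤) | toℕ-vertex z≤ =
    dec-true (alive? (k + suc j) (suc j) ×-dec alive? (k + suc j) (suc (suc j)))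
             (alive-newborn j , alive-suc (alive-newborn j) (distinct (suc j) (s≤s z≤n) 1+j<M ∘ flip-slot))
    where
    flip-slot : a (suc (suc j)) ≡ slot (k + suc j) → a (suc (suc j)) ≡ a (suc j)
    flip-slot e = trans e (slot-newborn j)

  separators-distinct< : ConsecutiveDistinct → ∀ {i j} → i < j → j < M → separator i ≢ separator j
  separators-distinct< distinct {i} {suc j} (s≤s i≤j) 1+j<M sep-i≡sep-1+j = false≢true (begin
    false                                  ≡⟨ newborn∉separator z≤ i≤j ⟨
    lookup (separator i) newborn           ≡⟨ cong (λ s → lookup s newborn) sep-i≡sep-1+j ⟩
    lookup (separator (suc j)) newborn     ≡⟨ newborn∈separator distinct z≤ 1+j<M ⟩
    true                                   ∎)
    where
    open ≡-Reasoning
    z≤ = +-monoʳ-≤ k (<⇒≤ 1+j<M)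
    newborn = vertex (k + suc j) z≤
    false≢true : false ≢ true
    false≢true ()

  separators-distinct : ConsecutiveDistinct → ∀ i j → i < M → j < M → i ≢ j → separator i ≢ separator j
  separators-distinct distinct i j i<M j<M i≢j with <-cmp i j
  ... | tri< i<j _ _ = separators-distinct< distinct i<j j<M
  ... | tri≈ _ i≡j _ = ⊥-elim (i≢j i≡j)
  ... | tri> _ _ j<i = separators-distinct< distinct j<i i<M ∘ sym

  slotGraph-isSimpleKPath : ConsecutiveDistinct → IsSimpleKPath k slotGraph
  slotGraph-isSimpleKPath distinct =
    suc M , bag , (covered , edge-in-bag , bag-interval)
    , (λ t t<1+M → ∣bag∣ t (s≤s⁻¹ t<1+M))
    , (λ t 1+t<1+M → ∣separator∣ t (s≤s⁻¹ 1+t<1+M))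
    , (λ i j 1+i<1+M 1+j<1+M → separators-distinct distinct i j (s≤s⁻¹ 1+i<1+M) (s≤s⁻¹ 1+j<1+M))
    , bag-clique
    where
    covered : ∀ v → ∃ λ t → t < suc M × v ∈ bag t
    covered v =
      birth (toℕ v) , s≤s (birth≤ (s≤s⁻¹ (toℕ<n v))) , alive⇒∈bag (birth (toℕ v)) (alive-birth (toℕ v))
    edge-in-bag : ∀ u v → Edge slotGraph u v → ∃ λ t → t < suc M × u ∈ bag t × v ∈ bag t
    edge-in-bag u v uv with does⇒ (adjacent? (toℕ u) (toℕ v)) uv
    ... | _ , t , t≤M , alive-u , alive-v = t , s≤s t≤M , alive⇒∈bag t alive-u , alive⇒∈bag t alive-v
    bag-interval : ∀ v i j l → i ≤ j → j ≤ l → l < suc M → v ∈ bag i → v ∈ bag l → v ∈ bag j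
    bag-interval v i j l i≤j j≤l _ v∈i v∈l =
      alive⇒∈bag j (alive-interval (∈bag⇒alive i v∈i) (∈bag⇒alive l v∈l) i≤j j≤l)
    bag-clique : ∀ t → t < suc M → ∀ u v → u ∈ bag t → v ∈ bag t → u ≢ v → Edge slotGraph u v
    bag-clique t t<1+M u v u∈ v∈ u≢v = dec-true (adjacent? (toℕ u) (toℕ v))
      (u≢v ∘ toℕ-injective , t , s≤s⁻¹ t<1+M , ∈bag⇒alive t u∈ , ∈bag⇒alive t v∈)

record BoundedIso (N : ℕ) (R S : ℕ → ℕ → Set) : Set where
  field
    to from   : ℕ → ℕ
    to-≤      : ∀ {u} → u ≤ N → to u ≤ N
    from-≤    : ∀ {u} → u ≤ N → from u ≤ N
    from-to   : ∀ {u} → u ≤ N → from (to u) ≡ u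
    to-from   : ∀ {u} → u ≤ N → to (from u) ≡ u
    preserves : ∀ {u v} → u ≤ N → v ≤ N → R u v → S (to u) (to v)
    reflects  : ∀ {u v} → u ≤ N → v ≤ N → S (to u) (to v) → R u v

  to-injective : ∀ {u v} → u ≤ N → v ≤ N → to u ≡ to v → u ≡ v
  to-injective u≤N v≤N e = trans (sym (from-to u≤N)) (trans (cong from e) (from-to v≤N))

  from-injective : ∀ {u v} → u ≤ N → v ≤ N → from u ≡ from v → u ≡ v
  from-injective u≤N v≤N e = trans (sym (to-from u≤N)) (trans (cong to e) (to-from v≤N))

BoundedIso-trans : ∀ {N R S T} → BoundedIso N R S → BoundedIso N S T → BoundedIso N R T
BoundedIso-trans I J = record
  { to        = J.to ∘ I.to
  ; from      = I.from ∘ J.from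
  ; to-≤      = J.to-≤ ∘ I.to-≤
  ; from-≤    = I.from-≤ ∘ J.from-≤
  ; from-to   = λ u≤N → trans (cong I.from (J.from-to (I.to-≤ u≤N))) (I.from-to u≤N)
  ; to-from   = λ u≤N → trans (cong J.to (I.to-from (J.from-≤ u≤N))) (J.to-from u≤N)
  ; preserves = λ u≤N v≤N → J.preserves (I.to-≤ u≤N) (I.to-≤ v≤N) ∘ I.preserves u≤N v≤N
  ; reflects  = λ u≤N v≤N → I.reflects u≤N v≤N ∘ J.reflects (I.to-≤ u≤N) (I.to-≤ v≤N)
  }
  where
  module I = BoundedIso I
  module J = BoundedIso J

module _ {N : ℕ} where

  onℕ : (Fin (suc N) → Fin (suc N)) → ℕ → ℕ
  onℕ h u with u ℕ.≤? N
  ... | yes u≤N = toℕ (h (fromℕ< (s≤s u≤N)))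
  ... | no  _   = u

  onℕ-toℕ : ∀ h (i : Fin (suc N)) → onℕ h (toℕ i) ≡ toℕ (h i)
  onℕ-toℕ h i with toℕ i ℕ.≤? N
  ... | yes i≤N = cong (toℕ ∘ h) (fromℕ<-toℕ i (s≤s i≤N))
  ... | no  i≰N = ⊥-elim (i≰N (s≤s⁻¹ (toℕ<n i)))

  ≤⇒toℕ : ∀ {u} → u ≤ N → ∃ λ (i : Fin (suc N)) → toℕ i ≡ u
  ≤⇒toℕ u≤N = fromℕ< (s≤s u≤N) , toℕ-fromℕ< (s≤s u≤N)

permutation⇒BoundedIso : ∀ {N R S} (π : Permutation′ (suc N)) →
  (∀ i j → R (toℕ i) (toℕ j) ⇔ S (toℕ (π ⟨$⟩ʳ i)) (toℕ (π ⟨$⟩ʳ j))) → BoundedIso N R S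
permutation⇒BoundedIso {N} {R} {S} π R⇔S = record
  { to = onℕ (π ⟨$⟩ʳ_) ; from = onℕ (π ⟨$⟩ˡ_)
  ; to-≤ = to-≤ ; from-≤ = from-≤ ; from-to = from-to ; to-from = to-from
  ; preserves = preserves ; reflects = reflects
  }
  where
  to-≤ : ∀ {u} → u ≤ N → onℕ (π ⟨$⟩ʳ_) u ≤ N
  to-≤ u≤N with ≤⇒toℕ u≤N
  ... | i , refl = subst (_≤ N) (sym (onℕ-toℕ (π ⟨$⟩ʳ_) i)) (s≤s⁻¹ (toℕ<n _))
  from-≤ : ∀ {u} → u ≤ N → onℕ (π ⟨$⟩ˡ_) u ≤ N
  from-≤ u≤N with ≤⇒toℕ u≤N
  ... | i , refl = subst (_≤ N) (sym (onℕ-toℕ (π ⟨$⟩ˡ_) i)) (s≤s⁻¹ (toℕ<n _))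
  from-to : ∀ {u} → u ≤ N → onℕ (π ⟨$⟩ˡ_) (onℕ (π ⟨$⟩ʳ_) u) ≡ u
  from-to u≤N with ≤⇒toℕ u≤N
  ... | i , refl rewrite onℕ-toℕ (π ⟨$⟩ʳ_) i | onℕ-toℕ (π ⟨$⟩ˡ_) (π ⟨$⟩ʳ i) =
    cong toℕ (inverseˡ π)
  to-from : ∀ {u} → u ≤ N → onℕ (π ⟨$⟩ʳ_) (onℕ (π ⟨$⟩ˡ_) u) ≡ u
  to-from u≤N with ≤⇒toℕ u≤N
  ... | i , refl rewrite onℕ-toℕ (π ⟨$⟩ˡ_) i | onℕ-toℕ (π ⟨$⟩ʳ_) (π ⟨$⟩ˡ i) =
    cong toℕ (inverseʳ π)
  preserves : ∀ {u v} → u ≤ N → v ≤ N → R u v → S (onℕ (π ⟨$⟩ʳ_) u) (onℕ (π ⟨$⟩ʳ_) v)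
  preserves u≤N v≤N with ≤⇒toℕ u≤N | ≤⇒toℕ v≤N
  ... | i , refl | j , refl rewrite onℕ-toℕ (π ⟨$⟩ʳ_) i | onℕ-toℕ (π ⟨$⟩ʳ_) j =
    Equivalence.to (R⇔S i j)
  reflects : ∀ {u v} → u ≤ N → v ≤ N → S (onℕ (π ⟨$⟩ʳ_) u) (onℕ (π ⟨$⟩ʳ_) v) → R u v
  reflects u≤N v≤N with ≤⇒toℕ u≤N | ≤⇒toℕ v≤N
  ... | i , refl | j , refl rewrite onℕ-toℕ (π ⟨$⟩ʳ_) i | onℕ-toℕ (π ⟨$⟩ʳ_) j =
    Equivalence.from (R⇔S i j)

slotIso⇒BoundedIso : ∀ {k M} (a b : ℕ → Fin (suc k)) →
  Iso (SlotGraph.slotGraph k M a) (SlotGraph.slotGraph k M b) →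
  BoundedIso (k + M) (SlotGraph.Adjacent k M a) (SlotGraph.Adjacent k M b)
slotIso⇒BoundedIso {k} {M} a b (π , adj≡) = permutation⇒BoundedIso π λ i j →
  does-≡⇒⇔ (A.adjacent? (toℕ i) (toℕ j)) (B.adjacent? (toℕ (π ⟨$⟩ʳ i)) (toℕ (π ⟨$⟩ʳ j)))
    (adj≡ i j)
  where
  module A = SlotGraph k M a
  module B = SlotGraph k M b

ClosedNeighbour : (ℕ → ℕ → Set) → ℕ → ℕ → Set
ClosedNeighbour R x u = u ≡ x ⊎ R x u

Simplicial : ℕ → (ℕ → ℕ → Set) → ℕ → Set
Simplicial N R x = ∀ {y z} → y ≤ N → z ≤ N → R x y → R x z → y ≢ z → R y z

module _ {N R S} (I : BoundedIso N R S) where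
  open BoundedIso I

  closedNeighbour-preserved : ∀ {x u} → x ≤ N → u ≤ N →
    ClosedNeighbour R x u → ClosedNeighbour S (to x) (to u)
  closedNeighbour-preserved x≤N u≤N (inj₁ u≡x) = inj₁ (cong to u≡x)
  closedNeighbour-preserved x≤N u≤N (inj₂ xu)  = inj₂ (preserves x≤N u≤N xu)

  closedNeighbour-reflected : ∀ {x u} → x ≤ N → u ≤ N →
    ClosedNeighbour S (to x) (to u) → ClosedNeighbour R x u
  closedNeighbour-reflected x≤N u≤N (inj₁ e)  = inj₁ (to-injective u≤N x≤N e)
  closedNeighbour-reflected x≤N u≤N (inj₂ xu) = inj₂ (reflects x≤N u≤N xu)

  simplicial-preserved : ∀ {x} → x ≤ N → Simplicial N R x → Simplicial N S (to x)
  simplicial-preserved {x} x≤N simplicial {y} {z} y≤N z≤N xy xz y≢z =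
    subst₂ S (to-from y≤N) (to-from z≤N)
      (preserves (from-≤ y≤N) (from-≤ z≤N)
        (simplicial (from-≤ y≤N) (from-≤ z≤N) (pull y≤N xy) (pull z≤N xz)
          (y≢z ∘ from-injective y≤N z≤N)))
    where
    pull : ∀ {w} → w ≤ N → S (to x) w → R x (from w)
    pull w≤N xw = reflects x≤N (from-≤ w≤N) (subst (S (to x)) (sym (to-from w≤N)) xw)

-- Rigidity

-- An isomorphism that maps the first bag onto itself induces a relabelling σ of the
-- slots; by induction on t it sends the occupant of each slot c at time t to the
-- occupant of slot σ c, and so b t ≡ σ (a t).
module Rigidity {k M : ℕ} {a b : ℕ → Fin (suc k)}
  (b-distinct : SlotGraph.ConsecutiveDistinct k M b)
  (I : BoundedIso (k + M) (SlotGraph.Adjacent k M a) (SlotGraph.Adjacent k M b))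
  (initial-preserved : ∀ {u} → u ≤ k → BoundedIso.to I u ≤ k)
  (initial-reflected : ∀ {u} → u ≤ k + M → BoundedIso.to I u ≤ k → u ≤ k)
  where
  open BoundedIso I
  module A = SlotGraph k M a
  module B = SlotGraph k M b

  toℕ≤k+M : ∀ (c : Fin (suc k)) → toℕ c ≤ k + M
  toℕ≤k+M c = ≤-trans (toℕ≤pred[n] c) (m≤m+n k M)

  σ : Fin (suc k) → Fin (suc k)
  σ c = clamp k (to (toℕ c))

  toℕ-σ : ∀ c → toℕ (σ c) ≡ to (toℕ c)
  toℕ-σ c = toℕ-clamp k _ (initial-preserved (toℕ≤pred[n] c))

  σ-injective : ∀ {c c′} → σ c ≡ σ c′ → c ≡ c′
  σ-injective {c} {c′} e = toℕ-injective (to-injective (toℕ≤k+M c) (toℕ≤k+M c′)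
    (trans (sym (toℕ-σ c)) (trans (cong toℕ e) (toℕ-σ c′))))

  σ-surjective : ∀ c′ → ∃ λ c → σ c ≡ c′
  σ-surjective c′ = clamp k u , toℕ-injective (begin
    toℕ (σ (clamp k u))  ≡⟨ toℕ-σ (clamp k u) ⟩
    to (toℕ (clamp k u)) ≡⟨ cong to (toℕ-clamp k u u≤k) ⟩
    to u                 ≡⟨ to-from (toℕ≤k+M c′) ⟩
    toℕ c′               ∎)
    where
    open ≡-Reasoning
    u = from (toℕ c′)
    u≤k : u ≤ k
    u≤k = initial-reflected (from-≤ (toℕ≤k+M c′))
            (subst (_≤ k) (sym (to-from (toℕ≤k+M c′))) (toℕ≤pred[n] c′))

  SlotwiseAt : ℕ → Set
  SlotwiseAt t = ∀ c → to (A.occupant c t) ≡ B.occupant (σ c) t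

  slotwise₀ : SlotwiseAt 0
  slotwise₀ c = sym (toℕ-σ c)

  module _ {t} (t<M : t < M) (slotwise-t : SlotwiseAt t) where

    newborn≤ : k + suc t ≤ k + M
    newborn≤ = +-monoʳ-≤ k t<M

    missing-newborn⇒replaced : ∀ c′ → ¬ B.Adjacent (B.occupant c′ t) (to (k + suc t)) → c′ ≡ σ (a (suc t))
    missing-newborn⇒replaced c′ ¬adjacent with σ-surjective c′
    ... | c , refl = cong σ (sym (A.¬Adjacent-newborn⇒replaced t<M λ adjacent →
      ¬adjacent (subst (λ w → B.Adjacent w (to (k + suc t))) (slotwise-t c)
        (preserves (≤-trans (A.occupant≤ c t) (+-monoʳ-≤ k (<⇒≤ t<M))) newborn≤ adjacent))))

    relabelled-step : to (k + suc t) ≡ k + suc t → b (suc t) ≡ σ (a (suc t))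
    relabelled-step fixed = missing-newborn⇒replaced (b (suc t))
      (subst (λ w → ¬ B.Adjacent (B.occupant (b (suc t)) t) w) (sym fixed) (B.replaced-¬Adjacent-newborn t))

    slotwise-suc : to (k + suc t) ≡ k + suc t → SlotwiseAt (suc t)
    slotwise-suc fixed c = by-cases (a (suc t) Fin.≟ c)
      where
      open ≡-Reasoning
      by-cases : Dec (a (suc t) ≡ c) → to (A.occupant c (suc t)) ≡ B.occupant (σ c) (suc t)
      by-cases (yes e) = begin
        to (A.occupant c (suc t)) ≡⟨ cong to (A.occupant-replaced c t e) ⟩
        to (k + suc t)            ≡⟨ fixed ⟩
        k + suc t                 ≡⟨ B.occupant-replaced (σ c) t (trans (relabelled-step fixed) (cong σ e)) ⟨
        B.occupant (σ c) (suc t)  ∎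
      by-cases (no ne) = begin
        to (A.occupant c (suc t)) ≡⟨ cong to (A.occupant-kept c t ne) ⟩
        to (A.occupant c t)       ≡⟨ slotwise-t c ⟩
        B.occupant (σ c) t        ≡⟨ B.occupant-kept (σ c) t (ne ∘ σ-injective ∘ trans (sym (relabelled-step fixed))) ⟨
        B.occupant (σ c) (suc t)  ∎

    -- Were the newborn sent to a younger vertex, the vertices of B evicted at times
    -- t + 1 and t + 2 would both miss its image, so b (t + 1) and b (t + 2) would
    -- both be σ (a (t + 1)).
    newborn-not-younger : ∀ {j} → t < j → to (k + suc t) ≢ k + suc j
    newborn-not-younger {j} t<j to-newborn≡ = b-distinct (suc t) (s≤s z≤n) 1+t<M (trans b₂≡ (sym b₁≡))
      where
      1+t<M : suc t < M
      1+t<M = <-≤-trans (s≤s t<j) (+-cancelˡ-≤ k (suc j) M (subst (_≤ k + M) to-newborn≡ (to-≤ newborn≤)))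
      misses : ∀ {c s} → B.Alive (B.occupant c s) s → ¬ B.Alive (B.occupant c s) (suc s) →
               k + suc s ≤ k + suc j → ¬ B.Adjacent (B.occupant c s) (to (k + suc t))
      misses alive dead younger =
        subst (λ w → ¬ B.Adjacent _ w) (sym to-newborn≡) (B.dead⇒¬Adjacent-younger alive dead younger)
      b₁≡ : b (suc t) ≡ σ (a (suc t))
      b₁≡ = missing-newborn⇒replaced (b (suc t))
        (misses (B.alive-occupant (b (suc t)) t) (B.replaced-dies t) (+-monoʳ-≤ k (<⇒≤ (s≤s t<j))))
      kept : B.occupant (b (suc (suc t))) (suc t) ≡ B.occupant (b (suc (suc t))) t
      kept = B.occupant-kept (b (suc (suc t))) t (b-distinct (suc t) (s≤s z≤n) 1+t<M ∘ sym)
      b₂≡ : b (suc (suc t)) ≡ σ (a (suc t))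
      b₂≡ = missing-newborn⇒replaced (b (suc (suc t)))
        (subst (λ w → ¬ B.Adjacent w (to (k + suc t))) kept
          (misses (B.alive-occupant (b (suc (suc t))) (suc t)) (B.replaced-dies (suc t)) (+-monoʳ-≤ k (s≤s t<j))))

  newborn-not-older : ∀ {t j} → t < M → (∀ {τ} → τ ≤ t → SlotwiseAt τ) → j < t → to (k + suc t) ≢ k + suc j
  newborn-not-older {t} {j} t<M slotwise j<t to-newborn≡ with σ-surjective (b (suc j))
  ... | c , σc≡ =
    <⇒≱ (+-monoʳ-< k (s≤s j<t)) (subst (_≤ k + suc j) occupant≡newborn (A.occupant≤ c (suc j)))
    where
    occupant≡newborn : A.occupant c (suc j) ≡ k + suc t
    occupant≡newborn =
      to-injective (≤-trans (A.occupant≤ c (suc j)) (+-monoʳ-≤ k (<-trans j<t t<M))) (+-monoʳ-≤ k t<M) (begin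
      to (A.occupant c (suc j))      ≡⟨ slotwise j<t c ⟩
      B.occupant (σ c) (suc j)       ≡⟨ B.occupant-replaced (σ c) j (sym σc≡) ⟩
      k + suc j                      ≡⟨ to-newborn≡ ⟨
      to (k + suc t)                 ∎)
      where open ≡-Reasoning

  newborn-fixed : ∀ {t} → t < M → (∀ {τ} → τ ≤ t → SlotwiseAt τ) → to (k + suc t) ≡ k + suc t
  newborn-fixed {t} t<M slotwise with ≤⊎≡+suc k (to (k + suc t))
  ... | inj₁ to≤k =
    ⊥-elim (k+1+t≰k+t k t (≤-trans (initial-reflected (+-monoʳ-≤ k t<M) to≤k) (m≤m+n k t)))
  ... | inj₂ (j , to≡) with <-cmp j t
  ...   | tri< j<t _ _ = ⊥-elim (newborn-not-older t<M slotwise j<t to≡)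
  ...   | tri≈ _ refl _ = to≡
  ...   | tri> _ _ t<j = ⊥-elim (newborn-not-younger t<M (slotwise ≤-refl) t<j to≡)

  slotwise : ∀ {t} → t ≤ M → ∀ {τ} → τ ≤ t → SlotwiseAt τ
  slotwise {zero}  _     z≤n = slotwise₀
  slotwise {suc t} t<M τ≤1+t with ≤-suc-cases τ≤1+t
  ... | inj₂ τ≤t  = slotwise (<⇒≤ t<M) τ≤t
  ... | inj₁ refl = slotwise-suc t<M (slotwise (<⇒≤ t<M) ≤-refl) (newborn-fixed t<M (slotwise (<⇒≤ t<M)))

  relabelled : ∀ t → 1 ≤ t → t ≤ M → b t ≡ σ (a t)
  relabelled (suc t) _ t<M =
    relabelled-step t<M (slotwise (<⇒≤ t<M) ≤-refl) (newborn-fixed t<M (slotwise (<⇒≤ t<M)))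

-- Reversal

reverseUpTo : ∀ {A : Set} → ℕ → (ℕ → A) → ℕ → A
reverseUpTo M b t = b (suc M ∸ t)

Reverses : ∀ {A : Set} → ℕ → (ℕ → A) → (ℕ → A) → Set
Reverses M a a′ = ∀ t → 1 ≤ t → t ≤ M → a′ t ≡ a (suc M ∸ t)

Reverses-sym : ∀ {A : Set} {M} {a a′ : ℕ → A} → Reverses M a a′ → Reverses M a′ a
Reverses-sym {M = M} {a} {a′} reverses (suc t) _ t<M = sym (begin
  a′ (suc M ∸ suc t)   ≡⟨ reverses (M ∸ t) (m<n⇒0<n∸m t<M) (m∸n≤m M t) ⟩
  a (suc M ∸ (M ∸ t)) ≡⟨ cong a (+-∸-mirror 1 (<⇒≤ t<M)) ⟩
  a (suc t)            ∎)
  where open ≡-Reasoning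

module Mirror {k M : ℕ} (a a′ : ℕ → Fin (suc k)) (reverses : Reverses M a a′) where
  module A  = SlotGraph k M a
  module A′ = SlotGraph k M a′

  mirror : ℕ → ℕ
  mirror u = A′.occupant (A.slot u) (M ∸ A.birth u)

  mirror-≤ : ∀ u → mirror u ≤ k + M
  mirror-≤ u = ≤-trans (A′.occupant≤ (A.slot u) _) (+-monoʳ-≤ k (m∸n≤m M (A.birth u)))

  mirror-occupant : ∀ c {τ} → τ ≤ M → mirror (A.occupant c τ) ≡ A′.occupant c (M ∸ τ)
  mirror-occupant c {zero} _ rewrite A.slot-toℕ c | m≤n⇒m∸n≡0 (toℕ≤pred[n] c) = refl
  mirror-occupant c {suc τ} τ<M = by-cases (a (suc τ) Fin.≟ c)
    where
    open ≡-Reasoning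
    a′-mirrored : a′ (suc (M ∸ suc τ)) ≡ a (suc τ)
    a′-mirrored = begin
      a′ (suc (M ∸ suc τ))        ≡⟨ cong a′ (+-∸-assoc 1 τ<M) ⟨
      a′ (M ∸ τ)                  ≡⟨ reverses (M ∸ τ) (m<n⇒0<n∸m τ<M) (m∸n≤m M τ) ⟩
      a (suc M ∸ (M ∸ τ))         ≡⟨ cong a (+-∸-mirror 1 (<⇒≤ τ<M)) ⟩
      a (suc τ)                   ∎
    by-cases : Dec (a (suc τ) ≡ c) → mirror (A.occupant c (suc τ)) ≡ A′.occupant c (M ∸ suc τ)
    by-cases (yes refl)
      rewrite A.occupant-replaced (a (suc τ)) τ refl | A.slot-newborn τ | m+n∸m≡n k (suc τ) = refl
    by-cases (no a≢c) = begin
      mirror (A.occupant c (suc τ))       ≡⟨ cong mirror (A.occupant-kept c τ a≢c) ⟩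
      mirror (A.occupant c τ)             ≡⟨ mirror-occupant c (<⇒≤ τ<M) ⟩
      A′.occupant c (M ∸ τ)               ≡⟨ cong (A′.occupant c) (+-∸-assoc 1 τ<M) ⟩
      A′.occupant c (suc (M ∸ suc τ))     ≡⟨ A′.occupant-kept c (M ∸ suc τ) (a≢c ∘ trans (sym a′-mirrored)) ⟩
      A′.occupant c (M ∸ suc τ)           ∎

  alive-mirror : ∀ {u τ} → τ ≤ M → A.Alive u τ → A′.Alive (mirror u) (M ∸ τ)
  alive-mirror {u} {τ} τ≤M alive =
    subst (λ w → A′.Alive w (M ∸ τ)) (trans (sym (mirror-occupant (A.slot u) τ≤M)) (cong mirror alive))
      (A′.alive-occupant (A.slot u) (M ∸ τ))

  alive-last⇒mirror-initial : ∀ {u} → A.Alive u M → mirror u ≤ k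
  alive-last⇒mirror-initial {u} alive = subst (_≤ k) toℕ-slot≡ (toℕ≤pred[n] (A.slot u))
    where
    toℕ-slot≡ : toℕ (A.slot u) ≡ mirror u
    toℕ-slot≡ = begin
      A′.occupant (A.slot u) 0         ≡⟨ cong (A′.occupant (A.slot u)) (n∸n≡0 M) ⟨
      A′.occupant (A.slot u) (M ∸ M)   ≡⟨ mirror-occupant (A.slot u) ≤-refl ⟨
      mirror (A.occupant (A.slot u) M) ≡⟨ cong mirror alive ⟩
      mirror u                         ∎
      where open ≡-Reasoning

  initial⇒mirror-alive-last : ∀ {w} → w ≤ k → A′.Alive (mirror w) M
  initial⇒mirror-alive-last {w} w≤k =
    subst (λ τ → A′.Alive (A′.occupant (A.slot w) τ) M) (sym (cong (M ∸_) (m≤n⇒m∸n≡0 w≤k)))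
      (A′.alive-occupant (A.slot w) M)

  Adjacent-mirror : ∀ {u v} → (mirror u ≡ mirror v → u ≡ v) →
    A.Adjacent u v → A′.Adjacent (mirror u) (mirror v)
  Adjacent-mirror mirror-injective (u≢v , τ , τ≤M , alive-u , alive-v) =
    u≢v ∘ mirror-injective , M ∸ τ , m∸n≤m M τ , alive-mirror τ≤M alive-u , alive-mirror τ≤M alive-v

mirror-involutive : ∀ {k M} (a a′ : ℕ → Fin (suc k)) (reverses : Reverses M a a′) {u} → u ≤ k + M →
  Mirror.mirror a′ a (Reverses-sym reverses) (Mirror.mirror a a′ reverses u) ≡ u
mirror-involutive {k} {M} a a′ reverses {u} u≤ = begin
  R′.mirror (R.mirror u)                         ≡⟨ cong (R′.mirror ∘ R.mirror) (A.alive-birth u) ⟨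
  R′.mirror (R.mirror (A.occupant (A.slot u) β)) ≡⟨ cong R′.mirror (R.mirror-occupant (A.slot u) β≤M) ⟩
  R′.mirror (A′.occupant (A.slot u) (M ∸ β))     ≡⟨ R′.mirror-occupant (A.slot u) (m∸n≤m M β) ⟩
  A.occupant (A.slot u) (M ∸ (M ∸ β))            ≡⟨ cong (A.occupant (A.slot u)) (m∸[m∸n]≡n β≤M) ⟩
  A.occupant (A.slot u) β                        ≡⟨ A.alive-birth u ⟩
  u                                              ∎
  where
  open ≡-Reasoning
  module A  = SlotGraph k M a
  module A′ = SlotGraph k M a′
  module R  = Mirror a a′ reverses
  module R′ = Mirror a′ a (Reverses-sym reverses)
  β = A.birth u
  β≤M = A.birth≤ u≤

module Reversal {k M : ℕ} (a a′ : ℕ → Fin (suc k)) (reverses : Reverses M a a′) where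
  module A  = SlotGraph k M a
  module A′ = SlotGraph k M a′
  module R  = Mirror a a′ reverses
  module R′ = Mirror a′ a (Reverses-sym reverses)

  mirror∘mirror : ∀ {u} → u ≤ k + M → R′.mirror (R.mirror u) ≡ u
  mirror∘mirror = mirror-involutive a a′ reverses

  mirror′∘mirror′ : ∀ {u} → u ≤ k + M → R.mirror (R′.mirror u) ≡ u
  mirror′∘mirror′ = mirror-involutive a′ a (Reverses-sym reverses)

  mirror-injective : ∀ {u v} → u ≤ k + M → v ≤ k + M → R.mirror u ≡ R.mirror v → u ≡ v
  mirror-injective u≤ v≤ e = trans (sym (mirror∘mirror u≤)) (trans (cong R′.mirror e) (mirror∘mirror v≤))

  reversal-iso : BoundedIso (k + M) A.Adjacent A′.Adjacent
  reversal-iso = record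
    { to        = R.mirror
    ; from      = R′.mirror
    ; to-≤      = λ {u} _ → R.mirror-≤ u
    ; from-≤    = λ {u} _ → R′.mirror-≤ u
    ; from-to   = mirror∘mirror
    ; to-from   = mirror′∘mirror′
    ; preserves = λ u≤ v≤ → R.Adjacent-mirror (mirror-injective u≤ v≤)
    ; reflects  = λ u≤ v≤ → subst₂ A.Adjacent (mirror∘mirror u≤) (mirror∘mirror v≤)
                             ∘ R′.Adjacent-mirror (mirror′-injective (R.mirror-≤ _) (R.mirror-≤ _))
    }
    where
    mirror′-injective : ∀ {u v} → u ≤ k + M → v ≤ k + M → R′.mirror u ≡ R′.mirror v → u ≡ v
    mirror′-injective u≤ v≤ e = trans (sym (mirror′∘mirror′ u≤)) (trans (cong R.mirror e) (mirror′∘mirror′ v≤))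

  mirror-initial⇒alive-last : ∀ {u} → u ≤ k + M → R.mirror u ≤ k → A.Alive u M
  mirror-initial⇒alive-last {u} u≤ mirror≤k =
    subst (λ w → A.Alive w M) (mirror∘mirror u≤) (R′.initial⇒mirror-alive-last mirror≤k)

reverseUpTo-reverses : ∀ {A : Set} M (b : ℕ → A) → Reverses M b (reverseUpTo M b)
reverseUpTo-reverses M b _ _ _ = refl

reverseUpTo-distinct : ∀ {k M} (b : ℕ → Fin (suc k)) →
  SlotGraph.ConsecutiveDistinct k M b → SlotGraph.ConsecutiveDistinct k M (reverseUpTo M b)
reverseUpTo-distinct {M = M} b distinct t 1≤t t<M b′≡ =
  distinct (M ∸ t) (m<n⇒0<n∸m t<M) (∸-monoʳ-< 1≤t (<⇒≤ t<M))
    (trans (cong b (sym (+-∸-assoc 1 (<⇒≤ t<M)))) (sym b′≡))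

-- The two ends of a slot graph

module Ends {k M : ℕ} (a : ℕ → Fin (suc k)) (1≤M : 1 ≤ M) (distinct : SlotGraph.ConsecutiveDistinct k M a) where
  open SlotGraph k M a

  -- The simplicial vertices: the first vertex to be evicted and the last one born.
  x₀ xₑ : ℕ
  x₀ = occupant (a 1) 0
  xₑ = k + M

  x₀≤k : x₀ ≤ k
  x₀≤k = toℕ≤pred[n] (a 1)

  alive-xₑ : Alive xₑ M
  alive-xₑ = subst (λ t → Alive (k + t) t) (m+[n∸m]≡n 1≤M) (alive-newborn (M ∸ 1))

  survivor-¬simplicial : ∀ {x t} → t < M → Alive x t → Alive x (suc t) → ¬ Simplicial (k + M) Adjacent x
  survivor-¬simplicial {x} {t} t<M alive alive′ simplicial =
    replaced-¬Adjacent-newborn t (simplicial z≤ y≤ x~z x~y z≢y)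
    where
    y = k + suc t
    z = occupant (a (suc t)) t
    y≤ : y ≤ k + M
    y≤ = +-monoʳ-≤ k t<M
    z≤ : z ≤ k + M
    z≤ = ≤-trans (occupant≤ (a (suc t)) t) (+-monoʳ-≤ k (<⇒≤ t<M))
    ≤k+t⇒≢y : ∀ {w} → w ≤ k + t → w ≢ y
    ≤k+t⇒≢y w≤ refl = k+1+t≰k+t k t w≤
    x~y : Adjacent x y
    x~y = ≤k+t⇒≢y (alive⇒≤ alive) , suc t , t<M , alive′ , alive-newborn t
    x~z : Adjacent x z
    x~z = (λ x≡z → replaced-dies t (subst (λ w → Alive w (suc t)) x≡z alive′))
        , t , <⇒≤ t<M , alive , alive-occupant (a (suc t)) t
    z≢y : z ≢ y
    z≢y = ≤k+t⇒≢y (occupant≤ (a (suc t)) t)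

  simplicial⇒end : ∀ {x} → x ≤ k + M → Simplicial (k + M) Adjacent x → x ≡ x₀ ⊎ x ≡ xₑ
  simplicial⇒end {x} x≤ simplicial with ≤⊎≡+suc k x
  ... | inj₁ x≤k = inj₁ (trans (sym alive₀) (cong toℕ (sym (death-slot alive₀ dies))))
    where
    alive₀ : Alive x 0
    alive₀ = toℕ-slot-initial x x≤k
    dies : ¬ Alive x 1
    dies alive₁ = survivor-¬simplicial 1≤M alive₀ alive₁ simplicial
  ... | inj₂ (j , refl) with m≤n⇒m<n∨m≡n (+-cancelˡ-≤ k (suc j) M x≤)
  ...   | inj₂ 1+j≡M = inj₂ (cong (k +_) 1+j≡M)
  ...   | inj₁ 1+j<M = ⊥-elim (distinct (suc j) (s≤s z≤n) 1+j<M
            (trans (death-slot (alive-newborn j) dies) (slot-newborn j)))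
    where
    dies : ¬ Alive (k + suc j) (suc (suc j))
    dies alive′ = survivor-¬simplicial 1+j<M (alive-newborn j) alive′ simplicial

  alive-x₀ : Alive x₀ 0
  alive-x₀ = alive-occupant (a 1) 0

  alive₀⇒initial : ∀ {u} → Alive u 0 → u ≤ k
  alive₀⇒initial alive = subst (_ ≤_) (+-identityʳ k) (alive⇒≤ alive)

  x₀-neighbour⇒alive₀ : ∀ {y} → Adjacent x₀ y → Alive y 0
  x₀-neighbour⇒alive₀ (_ , zero  , _ , _       , alive-y) = alive-y
  x₀-neighbour⇒alive₀ (_ , suc τ , _ , alive-x , _)       =
    ⊥-elim (replaced-dies 0 (alive-interval alive-x₀ alive-x z≤n (s≤s z≤n)))

  simplicial-x₀ : Simplicial (k + M) Adjacent x₀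
  simplicial-x₀ _ _ x₀~y x₀~z y≢z = y≢z , 0 , z≤n , x₀-neighbour⇒alive₀ x₀~y , x₀-neighbour⇒alive₀ x₀~z

  initial⇒closedNeighbour-x₀ : ∀ {u} → u ≤ k → ClosedNeighbour Adjacent x₀ u
  initial⇒closedNeighbour-x₀ {u} u≤k with u ℕ.≟ x₀
  ... | yes u≡x₀ = inj₁ u≡x₀
  ... | no  u≢x₀ = inj₂ (u≢x₀ ∘ sym , 0 , z≤n , alive-x₀ , toℕ-slot-initial u u≤k)

  closedNeighbour-x₀⇒initial : ∀ {u} → ClosedNeighbour Adjacent x₀ u → u ≤ k
  closedNeighbour-x₀⇒initial (inj₁ refl)   = x₀≤k
  closedNeighbour-x₀⇒initial (inj₂ x₀~u) = alive₀⇒initial (x₀-neighbour⇒alive₀ x₀~u)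

  alive-last⇒closedNeighbour-xₑ : ∀ {u} → Alive u M → ClosedNeighbour Adjacent xₑ u
  alive-last⇒closedNeighbour-xₑ {u} alive with u ℕ.≟ xₑ
  ... | yes u≡xₑ = inj₁ u≡xₑ
  ... | no  u≢xₑ = inj₂ (u≢xₑ ∘ sym , M , ≤-refl , alive-xₑ , alive)

  closedNeighbour-xₑ⇒alive-last : ∀ {u} → ClosedNeighbour Adjacent xₑ u → Alive u M
  closedNeighbour-xₑ⇒alive-last (inj₁ refl) = alive-xₑ
  closedNeighbour-xₑ⇒alive-last (inj₂ (_ , τ , τ≤M , alive-x , alive-u)) =
    subst (Alive _) (≤-antisym τ≤M (+-cancelˡ-≤ k M τ (alive⇒≤ alive-x))) alive-u

RelabelledOrReversed : (k M : ℕ) (a b : ℕ → Fin (suc k)) → Set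
RelabelledOrReversed k M a b = ∃ λ (σ : Fin (suc k) → Fin (suc k)) → Injective _≡_ _≡_ σ ×
  ((∀ t → 1 ≤ t → t ≤ M → b t ≡ σ (a t)) ⊎ (∀ t → 1 ≤ t → t ≤ M → b (suc M ∸ t) ≡ σ (a t)))

module Classification {k M : ℕ} {a b : ℕ → Fin (suc k)} (1≤M : 1 ≤ M)
  (a-distinct : SlotGraph.ConsecutiveDistinct k M a) (b-distinct : SlotGraph.ConsecutiveDistinct k M b)
  (I : BoundedIso (k + M) (SlotGraph.Adjacent k M a) (SlotGraph.Adjacent k M b))
  where
  open BoundedIso I
  module A  = SlotGraph k M a
  module B  = SlotGraph k M b
  module EA = Ends a 1≤M a-distinct
  module EB = Ends b 1≤M b-distinct

  x₀≤ : EA.x₀ ≤ k + M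
  x₀≤ = ≤-trans EA.x₀≤k (m≤m+n k M)

  x₀-image : to EA.x₀ ≡ EB.x₀ ⊎ to EA.x₀ ≡ EB.xₑ
  x₀-image = EB.simplicial⇒end (to-≤ x₀≤) (simplicial-preserved I x₀≤ EA.simplicial-x₀)

  initial⇒near-image : ∀ {u} → u ≤ k → ClosedNeighbour B.Adjacent (to EA.x₀) (to u)
  initial⇒near-image u≤k =
    closedNeighbour-preserved I x₀≤ (≤-trans u≤k (m≤m+n k M)) (EA.initial⇒closedNeighbour-x₀ u≤k)

  near-image⇒initial : ∀ {u} → u ≤ k + M → ClosedNeighbour B.Adjacent (to EA.x₀) (to u) → u ≤ k
  near-image⇒initial u≤ near = EA.closedNeighbour-x₀⇒initial (closedNeighbour-reflected I x₀≤ u≤ near)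

  retarget : ∀ {x y u} → x ≡ y → ClosedNeighbour B.Adjacent x u → ClosedNeighbour B.Adjacent y u
  retarget = subst (λ x → ClosedNeighbour B.Adjacent x _)

  relabelled-or-reversed : RelabelledOrReversed k M a b
  relabelled-or-reversed with x₀-image
  ... | inj₁ x₀↦x₀ = R.σ , R.σ-injective , inj₁ R.relabelled
    where
    module R = Rigidity {a = a} {b = b} b-distinct I
      (λ u≤k → EB.closedNeighbour-x₀⇒initial (retarget x₀↦x₀ (initial⇒near-image u≤k)))
      (λ u≤ to-u≤k → near-image⇒initial u≤ (retarget (sym x₀↦x₀) (EB.initial⇒closedNeighbour-x₀ to-u≤k)))
  ... | inj₂ x₀↦xₑ = R.σ , R.σ-injective , inj₂ R.relabelled
    where
    module Rev = Reversal b (reverseUpTo M b) (reverseUpTo-reverses M b)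
    module R = Rigidity {a = a} {b = reverseUpTo M b} (reverseUpTo-distinct b b-distinct)
      (BoundedIso-trans I Rev.reversal-iso)
      (λ u≤k → Rev.R.alive-last⇒mirror-initial
        (EB.closedNeighbour-xₑ⇒alive-last (retarget x₀↦xₑ (initial⇒near-image u≤k))))
      (λ u≤ mirror≤k → near-image⇒initial u≤ (retarget (sym x₀↦xₑ)
        (EB.alive-last⇒closedNeighbour-xₑ (Rev.mirror-initial⇒alive-last (to-≤ u≤) mirror≤k))))

-- Two families of pairwise non-isomorphic slot graphs

NonIsomorphicSimpleKPaths : (k n N : ℕ) → Set
NonIsomorphicSimpleKPaths k n N = ∃ λ (Gs : List (Graph n)) →
  All (IsSimpleKPath k) Gs × AllPairs (λ G H → ¬ Iso G H) Gs × N ≤ length Gs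

injectiveFamily⇒NonIsomorphic : ∀ {k n N} (G : Fin N → Graph n) → (∀ i → IsSimpleKPath k (G i)) →
  (∀ {i j} → Iso (G i) (G j) → i ≡ j) → NonIsomorphicSimpleKPaths k n N
injectiveFamily⇒NonIsomorphic G kpath iso⇒≡ =
  List.tabulate G , All.tabulate⁺ kpath , AllPairs.tabulate⁺ (λ i≢j → i≢j ∘ iso⇒≡)
  , ≤-reflexive (sym (length-tabulate G))

module _ {A : Set} where

  -- The sequence x₁, x₂, x₃, … with x_{t+3} = step (t + 3) x_{t+1} x_{t+2};
  -- its value at 0 is junk.
  recurrence₂ : A → A → (ℕ → A → A → A) → ℕ → A
  recurrence₂ x₁ x₂ step t = proj₁ (pairs (t ∸ 1))
    where
    pairs : ℕ → A × A
    pairs zero    = x₁ , x₂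
    pairs (suc j) = proj₂ (pairs j) , step (3 + j) (proj₁ (pairs j)) (proj₂ (pairs j))

  lookupOr : ∀ {n} → A → Vec A n → ℕ → A
  lookupOr d []       _       = d
  lookupOr d (x ∷ xs) zero    = x
  lookupOr d (x ∷ xs) (suc j) = lookupOr d xs j

  lookupOr-ext : ∀ {n} d (xs ys : Vec A n) → (∀ j → j < n → lookupOr d xs j ≡ lookupOr d ys j) → xs ≡ ys
  lookupOr-ext d []       []       _    = refl
  lookupOr-ext d (x ∷ xs) (y ∷ ys) same =
    cong₂ _∷_ (same zero (s≤s z≤n)) (lookupOr-ext d xs ys (λ j j<n → same (suc j) (s≤s j<n)))

  lookupOr-∷ʳ-< : ∀ {n} d (xs : Vec A n) x {j} → j < n → lookupOr d (xs Vec.∷ʳ x) j ≡ lookupOr d xs j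
  lookupOr-∷ʳ-< d (y ∷ xs) x {zero}  _         = refl
  lookupOr-∷ʳ-< d (y ∷ xs) x {suc j} (s≤s j<n) = lookupOr-∷ʳ-< d xs x j<n

  lookupOr-∷ʳ-last : ∀ {n} d (xs : Vec A n) x → lookupOr d (xs Vec.∷ʳ x) n ≡ x
  lookupOr-∷ʳ-last d []       x = refl
  lookupOr-∷ʳ-last d (y ∷ xs) x = lookupOr-∷ʳ-last d xs x

  lookupOr-reverse : ∀ {n} d (xs : Vec A n) {j} → j < n →
                     lookupOr d (Vec.reverse xs) j ≡ lookupOr d xs (n ∸ suc j)
  lookupOr-reverse {suc n} d (x ∷ xs) {j} j<1+n with m<1+n⇒m<n∨m≡n j<1+n
  ... | inj₁ j<n = begin
    lookupOr d (Vec.reverse (x ∷ xs)) j     ≡⟨ cong (λ ys → lookupOr d ys j) (reverse-∷ x xs) ⟩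
    lookupOr d (Vec.reverse xs Vec.∷ʳ x) j  ≡⟨ lookupOr-∷ʳ-< d (Vec.reverse xs) x j<n ⟩
    lookupOr d (Vec.reverse xs) j           ≡⟨ lookupOr-reverse d xs j<n ⟩
    lookupOr d (x ∷ xs) (suc (n ∸ suc j))   ≡⟨ cong (lookupOr d (x ∷ xs)) (+-∸-assoc 1 j<n) ⟨
    lookupOr d (x ∷ xs) (n ∸ j)             ∎
    where open ≡-Reasoning
  ... | inj₂ refl = begin
    lookupOr d (Vec.reverse (x ∷ xs)) n     ≡⟨ cong (λ ys → lookupOr d ys n) (reverse-∷ x xs) ⟩
    lookupOr d (Vec.reverse xs Vec.∷ʳ x) n  ≡⟨ lookupOr-∷ʳ-last d (Vec.reverse xs) x ⟩
    x                                       ≡⟨ cong (lookupOr d (x ∷ xs)) (n∸n≡0 n) ⟨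
    lookupOr d (x ∷ xs) (n ∸ n)             ∎
    where open ≡-Reasoning

funToFin-cong : ∀ {m n} {f g : Fin m → Fin n} → (∀ x → f x ≡ g x) → funToFin f ≡ funToFin g
funToFin-cong {zero}  _   = refl
funToFin-cong {suc m} f≗g = cong₂ Fin.combine (f≗g zero) (funToFin-cong (f≗g ∘ suc))

digitsWith : ∀ {m L} {B : Set} → (Fin m → B) → Fin (m ^ L) → Vec B L
digitsWith f i = tabulate (f ∘ finToFun i)

digitsWith-injective : ∀ {m L} {B : Set} (f : Fin m → B) → (∀ {x y} → f x ≡ f y → x ≡ y) →
  ∀ {i j : Fin (m ^ L)} → digitsWith f i ≡ digitsWith f j → i ≡ j
digitsWith-injective {m} {L} f f-injective {i} {j} e = begin
  i                    ≡⟨ funToFin-finToFin {L} {m} i ⟨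
  funToFin {L} (finToFun {m} i) ≡⟨ funToFin-cong {L} {m} (λ x → f-injective (begin
    f (finToFun i x)                  ≡⟨ lookup∘tabulate (f ∘ finToFun i) x ⟨
    Vec.lookup (digitsWith f i) x     ≡⟨ cong (λ v → Vec.lookup v x) e ⟩
    Vec.lookup (digitsWith f j) x     ≡⟨ lookup∘tabulate (f ∘ finToFun j) x ⟩
    f (finToFun j x)                  ∎)) ⟩
  funToFin {L} (finToFun {m} j) ≡⟨ funToFin-finToFin {L} {m} j ⟩
  j                    ∎
  where open ≡-Reasoning

injective-fixing-below⇒id : ∀ {k} (σ : Fin (suc k) → Fin (suc k)) → Injective _≡_ _≡_ σ →
  (∀ c → toℕ c < k → σ c ≡ c) → ∀ c → σ c ≡ c
injective-fixing-below⇒id {k} σ σ-injective fixed c with toℕ c ℕ.<? k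
... | yes c<k = fixed c c<k
... | no  c≮k with toℕ (σ c) ℕ.<? k
...   | yes σc<k = ⊥-elim (c≮k (subst (λ x → toℕ x < k) (σ-injective (fixed (σ c) σc<k)) σc<k))
...   | no  σc≮k = toℕ-injective (trans (≤-antisym (toℕ≤pred[n] (σ c)) (≮⇒≥ σc≮k))
                                        (sym (≤-antisym (toℕ≤pred[n] c) (≮⇒≥ c≮k))))

module WideFamily (k₀ L : ℕ) where

  k M : ℕ
  k = 3 + k₀
  M = suc (k + L)

  -- Slots 0, 1, …, k − 1 in order, then L free moves to any slot other than the
  -- current one, then a step back to the slot used two steps earlier.
  step : Vec (Fin k) L → ℕ → Fin (suc k) → Fin (suc k) → Fin (suc k)
  step w t p q with t ≤? k | t ≤? k + L
  ... | yes _ | _     = clamp k (t ∸ 1)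
  ... | no  _ | yes _ = punchIn q (lookupOr zero w (t ∸ suc k))
  ... | no  _ | no  _ = p

  slots : Vec (Fin k) L → ℕ → Fin (suc k)
  slots w = recurrence₂ zero (clamp k 1) (step w)

  step-prefix : ∀ w t p q → t ≤ k → step w t p q ≡ clamp k (t ∸ 1)
  step-prefix w t p q t≤k with t ≤? k
  ... | yes _   = refl
  ... | no  t≰k = ⊥-elim (t≰k t≤k)

  step-middle : ∀ w t p q → ¬ t ≤ k → t ≤ k + L → step w t p q ≡ punchIn q (lookupOr zero w (t ∸ suc k))
  step-middle w t p q t≰k t≤k+L with t ≤? k | t ≤? k + L
  ... | yes t≤k | _         = ⊥-elim (t≰k t≤k)
  ... | no  _   | yes _     = refl
  ... | no  _   | no  t≰k+L = ⊥-elim (t≰k+L t≤k+L)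

  step-last : ∀ w t p q → ¬ t ≤ k + L → step w t p q ≡ p
  step-last w t p q t≰k+L with t ≤? k | t ≤? k + L
  ... | yes t≤k | _         = ⊥-elim (t≰k+L (≤-trans t≤k (m≤m+n k L)))
  ... | no  _   | yes t≤k+L = ⊥-elim (t≰k+L t≤k+L)
  ... | no  _   | no  _     = refl

  toℕ-slots-prefix : ∀ w t → 1 ≤ t → t ≤ k → toℕ (slots w t) ≡ t ∸ 1
  toℕ-slots-prefix w 1 _ _ = refl
  toℕ-slots-prefix w 2 _ _ = toℕ-clamp k 1 (s≤s z≤n)
  toℕ-slots-prefix w (suc (suc (suc j))) _ 3+j≤k =
    trans (cong toℕ (step-prefix w (3 + j) _ _ 3+j≤k)) (toℕ-clamp k (2 + j) (<⇒≤ 3+j≤k))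

  slots-middle : ∀ w j → j < L → slots w (suc k + j) ≡ punchIn (slots w (k + j)) (lookupOr zero w j)
  slots-middle w j j<L = trans
    (step-middle w (suc k + j) _ _ (λ 1+k+j≤k → 1+n≰n (≤-trans (s≤s (m≤m+n k j)) 1+k+j≤k))
      (subst (_≤ k + L) (+-suc k j) (+-monoʳ-≤ k j<L)))
    (cong (punchIn (slots w (k + j)) ∘ lookupOr zero w) (m+n∸m≡n (suc k) j))

  slots-last : ∀ w → slots w M ≡ slots w (2 + k₀ + L)
  slots-last w = step-last w M _ _ 1+n≰n

  slots-distinct : ∀ w t → 1 ≤ t → slots w (suc t) ≢ slots w t
  slots-distinct w 1 _ e = 1≢0 (cong toℕ e)
    where
    1≢0 : toℕ (clamp k 1) ≢ 0
    1≢0 e′ with trans (sym (toℕ-clamp k 1 (s≤s z≤n))) e′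
    ... | ()
  slots-distinct w (suc (suc j)) _ = by-cases (3 + j ≤? k) (3 + j ≤? k + L) (slots-distinct w (suc j) (s≤s z≤n))
    where
    by-cases : Dec (3 + j ≤ k) → Dec (3 + j ≤ k + L) →
               slots w (2 + j) ≢ slots w (1 + j) → slots w (3 + j) ≢ slots w (2 + j)
    by-cases (yes 3+j≤k) _ _ e = 1+n≰n (≤-reflexive (trans
      (sym (toℕ-slots-prefix w (3 + j) (s≤s z≤n) 3+j≤k))
      (trans (cong toℕ e) (toℕ-slots-prefix w (2 + j) (s≤s z≤n) (<⇒≤ 3+j≤k)))))
    by-cases (no 3+j≰k) (yes 3+j≤k+L) _ =
      punchInᵢ≢i (slots w (2 + j)) _ ∘ trans (sym (step-middle w (3 + j) _ _ 3+j≰k 3+j≤k+L))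
    by-cases (no _) (no 3+j≰k+L) previous = previous ∘ sym ∘ trans (sym (step-last w (3 + j) _ _ 3+j≰k+L))

  slots-prefix : ∀ w (c : Fin (suc k)) → toℕ c < k → slots w (suc (toℕ c)) ≡ c
  slots-prefix w c c<k = toℕ-injective (toℕ-slots-prefix w (suc (toℕ c)) (s≤s z≤n) c<k)

  relabelled⇒≡ : ∀ {w w′} {σ : Fin (suc k) → Fin (suc k)} → Injective _≡_ _≡_ σ →
    (∀ t → 1 ≤ t → t ≤ M → slots w′ t ≡ σ (slots w t)) → w ≡ w′
  relabelled⇒≡ {w} {w′} {σ} σ-injective relabelled = lookupOr-ext zero w w′ λ j j<L →
    punchIn-injective (slots w (k + j)) _ _ (begin
      punchIn (slots w (k + j)) (lookupOr zero w j)   ≡⟨ slots-middle w j j<L ⟨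
      slots w (suc k + j)                             ≡⟨ same (s≤s z≤n) (s≤s (k+j≤k+L j<L)) ⟩
      slots w′ (suc k + j)                            ≡⟨ slots-middle w′ j j<L ⟩
      punchIn (slots w′ (k + j)) (lookupOr zero w′ j) ≡⟨ cong (λ c → punchIn c _)
                                                           (same (s≤s z≤n) (m≤n⇒m≤1+n (k+j≤k+L j<L))) ⟨
      punchIn (slots w (k + j)) (lookupOr zero w′ j)  ∎)
    where
    open ≡-Reasoning
    k+j≤k+L : ∀ {j} → j < L → k + j ≤ k + L
    k+j≤k+L = +-monoʳ-≤ k ∘ <⇒≤
    σ-fixes-prefix : ∀ c → toℕ c < k → σ c ≡ c
    σ-fixes-prefix c c<k = begin
      σ c                       ≡⟨ cong σ (slots-prefix w c c<k) ⟨
      σ (slots w (suc (toℕ c))) ≡⟨ relabelled (suc (toℕ c)) (s≤s z≤n) (m≤n⇒m≤1+n (≤-trans c<k (m≤m+n k L))) ⟨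
      slots w′ (suc (toℕ c))    ≡⟨ slots-prefix w′ c c<k ⟩
      c                         ∎
    same : ∀ {t} → 1 ≤ t → t ≤ M → slots w t ≡ slots w′ t
    same 1≤t t≤M = sym (trans (relabelled _ 1≤t t≤M) (injective-fixing-below⇒id σ σ-injective σ-fixes-prefix _))

  ¬reversed : ∀ {w w′} {σ : Fin (suc k) → Fin (suc k)} →
              ¬ (∀ t → 1 ≤ t → t ≤ M → slots w′ (suc M ∸ t) ≡ σ (slots w t))
  ¬reversed {w} {w′} {σ} reversed = 0≢2 (cong toℕ (begin
    slots w′ 1                      ≡⟨ cong (slots w′) (m+n∸n≡m 1 M) ⟨
    slots w′ (suc M ∸ M)            ≡⟨ reversed M (s≤s z≤n) ≤-refl ⟩
    σ (slots w M)                   ≡⟨ cong σ (slots-last w) ⟩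
    σ (slots w (2 + k₀ + L))        ≡⟨ reversed (2 + k₀ + L) (s≤s z≤n) (≤-trans (n≤1+n _) (n≤1+n _)) ⟨
    slots w′ (suc M ∸ (2 + k₀ + L)) ≡⟨ cong (slots w′) (m+n∸n≡m 3 (2 + k₀ + L)) ⟩
    slots w′ 3                      ∎))
    where
    open ≡-Reasoning
    0≢2 : toℕ (slots w′ 1) ≢ toℕ (slots w′ 3)
    0≢2 e with trans e (toℕ-slots-prefix w′ 3 (s≤s z≤n) (s≤s (s≤s (s≤s z≤n))))
    ... | ()

  word : Fin (k ^ L) → Vec (Fin k) L
  word = digitsWith id

  graph : Fin (k ^ L) → Graph (suc (k + M))
  graph i = SlotGraph.slotGraph k M (slots (word i))

  relabelledOrReversed⇒≡ : ∀ {i j} → RelabelledOrReversed k M (slots (word i)) (slots (word j)) → i ≡ j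
  relabelledOrReversed⇒≡ (_ , σ-injective , inj₁ relabelled) =
    digitsWith-injective id id (relabelled⇒≡ σ-injective relabelled)
  relabelledOrReversed⇒≡ {i} {j} (σ , _ , inj₂ reversed) = ⊥-elim (¬reversed {word i} {word j} {σ} reversed)

  graph-injective : ∀ {i j} → Iso (graph i) (graph j) → i ≡ j
  graph-injective {i} {j} iso = relabelledOrReversed⇒≡ (Classification.relabelled-or-reversed
    {a = slots (word i)} {b = slots (word j)} (s≤s z≤n)
    (λ t 1≤t _ → slots-distinct _ t 1≤t) (λ t 1≤t _ → slots-distinct _ t 1≤t)
    (slotIso⇒BoundedIso _ _ iso))

third : Fin 3 → Fin 3 → Fin 3
third 0F 1F = 2F
third 1F 0F = 2F
third 0F 2F = 1F
third 2F 0F = 1F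
third 1F 2F = 0F
third 2F 1F = 0F
third _  _  = 0F

third-fresh : ∀ p q → p ≢ q → third p q ≢ p × third p q ≢ q
third-fresh 0F 0F p≢q = ⊥-elim (p≢q refl)
third-fresh 1F 1F p≢q = ⊥-elim (p≢q refl)
third-fresh 2F 2F p≢q = ⊥-elim (p≢q refl)
third-fresh 0F 1F _   = (λ ()) , (λ ())
third-fresh 1F 0F _   = (λ ()) , (λ ())
third-fresh 0F 2F _   = (λ ()) , (λ ())
third-fresh 2F 0F _   = (λ ()) , (λ ())
third-fresh 1F 2F _   = (λ ()) , (λ ())
third-fresh 2F 1F _   = (λ ()) , (λ ())

reverse-∷ʳ : ∀ {A : Set} {n} (xs : Vec A n) y → reverse (xs ∷ʳ y) ≡ y ∷ reverse xs
reverse-∷ʳ []       y = refl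
reverse-∷ʳ (x ∷ xs) y = begin
  reverse (x ∷ (xs ∷ʳ y))    ≡⟨ reverse-∷ x (xs ∷ʳ y) ⟩
  reverse (xs ∷ʳ y) ∷ʳ x     ≡⟨ cong (_∷ʳ x) (reverse-∷ʳ xs y) ⟩
  y ∷ (reverse xs ∷ʳ x)      ≡⟨ cong (y ∷_) (reverse-∷ x xs) ⟨
  y ∷ reverse (x ∷ xs)       ∎
  where open ≡-Reasoning

-- Each leading pair (true , c) of the input becomes a palindromic shell c … c around
-- a core [false], [true , true] or false ∷ r ∷ʳ true.  Only the last core is not a
-- palindrome, and its reversal true ∷ … ∷ʳ false is not a core, so a code is the
-- reversal of another code only if the two are equal.
orientedCode : ∀ {n} → Vec Bool n → Vec Bool (suc n)
orientedCode []            = false ∷ []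
orientedCode (false ∷ r)   = false ∷ (r ∷ʳ true)
orientedCode (true ∷ [])   = true ∷ true ∷ []
orientedCode (true ∷ c ∷ r) = c ∷ (orientedCode r ∷ʳ c)

orientedCode-injective : ∀ {n} {x y : Vec Bool n} → orientedCode x ≡ orientedCode y → x ≡ y
orientedCode-injective {x = []}           {[]}            _ = refl
orientedCode-injective {x = false ∷ r}    {false ∷ r′}    e =
  cong (false ∷_) (∷ʳ-injectiveˡ r r′ (∷-injectiveʳ e))
orientedCode-injective {x = false ∷ []}   {true ∷ []}     ()
orientedCode-injective {x = false ∷ r}    {true ∷ c ∷ r′} e with ∷-injective e
... | refl , e′ with ∷ʳ-injectiveʳ r (orientedCode r′) e′
... | ()
orientedCode-injective {x = true ∷ []}    {false ∷ []}    ()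
orientedCode-injective {x = true ∷ []}    {true ∷ []}     _ = refl
orientedCode-injective {x = true ∷ c ∷ r} {false ∷ r′}    e with ∷-injective e
... | refl , e′ with ∷ʳ-injectiveʳ (orientedCode r) r′ e′
... | ()
orientedCode-injective {x = true ∷ c ∷ r} {true ∷ c′ ∷ r′} e with ∷-injective e
... | refl , e′ =
  cong (λ r → true ∷ c ∷ r) (orientedCode-injective (∷ʳ-injectiveˡ (orientedCode r) (orientedCode r′) e′))

reverse-shell : ∀ {A : Set} {n} x (w : Vec A n) y → reverse (x ∷ (w ∷ʳ y)) ≡ y ∷ (reverse w ∷ʳ x)
reverse-shell x w y = trans (reverse-∷ x (w ∷ʳ y)) (cong (_∷ʳ x) (reverse-∷ʳ w y))

orientedCode≡reverse⇒≡ : ∀ {n} {x y : Vec Bool n} → orientedCode x ≡ reverse (orientedCode y) → x ≡ y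
orientedCode≡reverse⇒≡ {x = []} {[]} _ = refl
orientedCode≡reverse⇒≡ {x = false ∷ r} {false ∷ r′} e with ∷-injectiveˡ (trans e (reverse-shell false r′ true))
... | ()
orientedCode≡reverse⇒≡ {x = false ∷ []} {true ∷ []} e with ∷-injectiveˡ e
... | ()
orientedCode≡reverse⇒≡ {x = false ∷ r} {true ∷ c′ ∷ r′} e with ∷-injective (trans e (reverse-shell c′ (orientedCode r′) c′))
... | refl , e′ with ∷ʳ-injectiveʳ r (reverse (orientedCode r′)) e′
... | ()
orientedCode≡reverse⇒≡ {x = true ∷ []} {false ∷ []} e with ∷-injectiveˡ (∷-injectiveʳ (trans e (reverse-shell false [] true)))
... | ()
orientedCode≡reverse⇒≡ {x = true ∷ []} {true ∷ []} _ = refl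
orientedCode≡reverse⇒≡ {x = true ∷ c ∷ r} {false ∷ r′} e with ∷-injective (trans e (reverse-shell false r′ true))
... | refl , e′ with ∷ʳ-injectiveʳ (orientedCode r) (reverse r′) e′
... | ()
orientedCode≡reverse⇒≡ {x = true ∷ c ∷ r} {true ∷ c′ ∷ r′} e with ∷-injective (trans e (reverse-shell c′ (orientedCode r′) c′))
... | refl , e′ = cong (λ r → true ∷ c ∷ r)
  (orientedCode≡reverse⇒≡ (∷ʳ-injectiveˡ (orientedCode r) (reverse (orientedCode r′)) e′))

Fin2→Bool-injective : ∀ {x y} → Inverse.to 2↔Bool x ≡ Inverse.to 2↔Bool y → x ≡ y
Fin2→Bool-injective {0F} {0F} _ = refl
Fin2→Bool-injective {1F} {1F} _ = refl
Fin2→Bool-injective {0F} {1F} ()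
Fin2→Bool-injective {1F} {0F} ()

differs : Fin 3 → Fin 3 → Bool
differs x y = not (does (x Fin.≟ y))

differs-sym : ∀ x y → differs x y ≡ differs y x
differs-sym x y = cong not (does-⇔ (mk⇔ sym sym) (x Fin.≟ y) (y Fin.≟ x))

differs-injective : ∀ {σ : Fin 3 → Fin 3} → Injective _≡_ _≡_ σ →
                    ∀ x y → differs (σ x) (σ y) ≡ differs x y
differs-injective σ-injective x y = cong not (does-⇔ (mk⇔ σ-injective (cong _)) (_ Fin.≟ _) (x Fin.≟ y))

module NarrowFamily (L : ℕ) where

  M : ℕ
  M = suc (2 + L)

  -- After slots 0, 1, the bit β j decides whether slot t = j + 3 returns to the slot
  -- of time j + 1 or moves to the third one.
  slots : (ℕ → Bool) → ℕ → Fin 3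
  slots β = recurrence₂ 0F 1F (λ t p q → if β (t ∸ 3) then third p q else p)

  slots-distinct : ∀ β t → 1 ≤ t → slots β (suc t) ≢ slots β t
  slots-distinct β 1 _ ()
  slots-distinct β (suc (suc j)) _ with β j | slots-distinct β (suc j) (s≤s z≤n)
  ... | true  | previous = proj₂ (third-fresh _ _ (previous ∘ sym))
  ... | false | previous = previous ∘ sym

  turns : (ℕ → Fin 3) → ℕ → Bool
  turns a j = differs (a (3 + j)) (a (1 + j))

  turns-slots : ∀ β j → turns (slots β) j ≡ β j
  turns-slots β j with β j | slots-distinct β (suc j) (s≤s z≤n)
  ... | true  | previous = cong not (dec-false (_ Fin.≟ _) (proj₁ (third-fresh _ _ (previous ∘ sym))))
  ... | false | _        = cong not (dec-true (slots β (1 + j) Fin.≟ slots β (1 + j)) refl)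

  code : Fin (2 ^ L) → Vec Bool (suc L)
  code i = orientedCode (digitsWith (Inverse.to 2↔Bool) i)

  bit : Fin (2 ^ L) → ℕ → Bool
  bit i = lookupOr false (code i)

  graph : Fin (2 ^ L) → Graph (suc (2 + M))
  graph i = SlotGraph.slotGraph 2 M (slots (bit i))

  code-injective : ∀ {i j} → code i ≡ code j → i ≡ j
  code-injective = digitsWith-injective (Inverse.to 2↔Bool) Fin2→Bool-injective ∘ orientedCode-injective

  module _ {a b : ℕ → Fin 3} {σ : Fin 3 → Fin 3} (σ-injective : Injective _≡_ _≡_ σ) where

    turns-relabelled : (∀ t → 1 ≤ t → t ≤ M → b t ≡ σ (a t)) → ∀ {d} → d ≤ L → turns b d ≡ turns a d
    turns-relabelled relabelled {d} d≤L = trans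
      (cong₂ differs (relabelled (3 + d) (s≤s z≤n) (+-monoʳ-≤ 3 d≤L))
                     (relabelled (1 + d) (s≤s z≤n) (≤-trans (s≤s d≤L) (m≤n+m _ 2))))
      (differs-injective σ-injective (a (3 + d)) (a (1 + d)))

    turns-reversed : (∀ t → 1 ≤ t → t ≤ M → b (suc M ∸ t) ≡ σ (a t)) →
                     ∀ {d} → d ≤ L → turns b d ≡ turns a (L ∸ d)
    turns-reversed reversed {d} d≤L = begin
      differs (b (3 + d)) (b (1 + d))                    ≡⟨ cong₂ (λ x y → differs (b x) (b y))
                                                              (+-∸-mirror 3 d≤L) (+-∸-mirror 1 d≤L) ⟨
      differs (b (suc M ∸ (1 + e))) (b (suc M ∸ (3 + e))) ≡⟨ cong₂ differs
                                                              (reversed (1 + e) (s≤s z≤n) (s≤s (≤-trans (m∸n≤m L d) (m≤n+m L 2))))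
                                                              (reversed (3 + e) (s≤s z≤n) (+-monoʳ-≤ 3 (m∸n≤m L d))) ⟩
      differs (σ (a (1 + e))) (σ (a (3 + e)))             ≡⟨ differs-injective σ-injective (a (1 + e)) (a (3 + e)) ⟩
      differs (a (1 + e)) (a (3 + e))                     ≡⟨ differs-sym (a (1 + e)) (a (3 + e)) ⟩
      differs (a (3 + e)) (a (1 + e))                     ∎
      where
      open ≡-Reasoning
      e = L ∸ d

  relabelled⇒≡ : ∀ {i j} {σ : Fin 3 → Fin 3} → Injective _≡_ _≡_ σ →
    (∀ t → 1 ≤ t → t ≤ M → slots (bit j) t ≡ σ (slots (bit i) t)) → i ≡ j
  relabelled⇒≡ {i} {j} σ-injective relabelled =
    code-injective (lookupOr-ext false (code i) (code j) λ d d<1+L → begin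
    bit i d                 ≡⟨ turns-slots (bit i) d ⟨
    turns (slots (bit i)) d ≡⟨ turns-relabelled {slots (bit i)} {slots (bit j)} σ-injective relabelled
                                 (s≤s⁻¹ d<1+L) ⟨
    turns (slots (bit j)) d ≡⟨ turns-slots (bit j) d ⟩
    bit j d                 ∎)
    where open ≡-Reasoning

  reversed⇒≡ : ∀ {i j} {σ : Fin 3 → Fin 3} → Injective _≡_ _≡_ σ →
    (∀ t → 1 ≤ t → t ≤ M → slots (bit j) (suc M ∸ t) ≡ σ (slots (bit i) t)) → i ≡ j
  reversed⇒≡ {i} {j} σ-injective reversed = sym (digitsWith-injective (Inverse.to 2↔Bool) Fin2→Bool-injective
    (orientedCode≡reverse⇒≡ (lookupOr-ext false (code j) (reverse (code i)) λ d d<1+L → begin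
      bit j d                           ≡⟨ turns-slots (bit j) d ⟨
      turns (slots (bit j)) d           ≡⟨ turns-reversed {slots (bit i)} {slots (bit j)} σ-injective reversed
                                             (s≤s⁻¹ d<1+L) ⟩
      turns (slots (bit i)) (L ∸ d)     ≡⟨ turns-slots (bit i) (L ∸ d) ⟩
      bit i (L ∸ d)                     ≡⟨ lookupOr-reverse false (code i) d<1+L ⟨
      lookupOr false (reverse (code i)) d ∎)))
    where open ≡-Reasoning

  relabelledOrReversed⇒≡ : ∀ {i j} → RelabelledOrReversed 2 M (slots (bit i)) (slots (bit j)) → i ≡ j
  relabelledOrReversed⇒≡ (_ , σ-injective , inj₁ relabelled) = relabelled⇒≡ σ-injective relabelled
  relabelledOrReversed⇒≡ (_ , σ-injective , inj₂ reversed)   = reversed⇒≡ σ-injective reversed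

  graph-injective : ∀ {i j} → Iso (graph i) (graph j) → i ≡ j
  graph-injective {i} {j} iso = relabelledOrReversed⇒≡ (Classification.relabelled-or-reversed
    {a = slots (bit i)} {b = slots (bit j)} (s≤s z≤n)
    (λ t 1≤t _ → slots-distinct (bit i) t 1≤t) (λ t 1≤t _ → slots-distinct (bit j) t 1≤t)
    (slotIso⇒BoundedIso _ _ iso))

alternating : ∀ {k} → ℕ → Fin (2 + k)
alternating zero          = zero
alternating (suc zero)    = suc zero
alternating (suc (suc t)) = alternating t

alternating-distinct : ∀ {k} t → alternating {k} (suc t) ≢ alternating t
alternating-distinct zero          ()
alternating-distinct (suc zero)    ()
alternating-distinct (suc (suc t)) = alternating-distinct t

someSimpleKPath : ∀ k M → 1 ≤ k → NonIsomorphicSimpleKPaths k (suc (k + M)) 1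
someSimpleKPath (suc k) M _ =
  (SlotGraph.slotGraph (suc k) M alternating ∷ [])
  , (SlotKPath.slotGraph-isSimpleKPath (suc k) M alternating (λ t _ _ → alternating-distinct t) ∷ [])
  , ([] ∷ [])
  , ≤-refl

nonIsomorphicFamily : ∀ k L → 2 ≤ k → NonIsomorphicSimpleKPaths k (suc (k + suc (k + L))) (k ^ L)
nonIsomorphicFamily zero L ()
nonIsomorphicFamily (suc zero) L (s≤s ())
nonIsomorphicFamily (suc (suc zero)) L _ = injectiveFamily⇒NonIsomorphic graph
  (λ i → SlotKPath.slotGraph-isSimpleKPath 2 M (slots (bit i)) (λ t 1≤t _ → slots-distinct (bit i) t 1≤t))
  graph-injective
  where open NarrowFamily L
nonIsomorphicFamily (suc (suc (suc k₀))) L _ = injectiveFamily⇒NonIsomorphic graph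
  (λ i → SlotKPath.slotGraph-isSimpleKPath k M (slots _) (λ t 1≤t _ → slots-distinct _ t 1≤t))
  graph-injective
  where open WideFamily k₀ L

family-order : ∀ k L → suc (k + suc (k + L)) ≡ 2 * k + 2 + L
family-order = solve-∀

lemma4p2 : (k n : ℕ) → 2 ≤ k → k + 4 ≤ n →
    ∃ λ (Gs : List (Graph n)) →
      All (IsSimpleKPath k) Gs
      × AllPairs (λ G H → ¬ Iso G H) Gs
      × k ^ (n ∸ (2 * k + 2)) ≤ length Gs
lemma4p2 k n 2≤k k+4≤n with 2 * k + 2 ≤? n
... | yes 2k+2≤n = subst (λ m → NonIsomorphicSimpleKPaths k m (k ^ L)) vertices (nonIsomorphicFamily k L 2≤k)
  where
  L = n ∸ (2 * k + 2)
  vertices : suc (k + suc (k + L)) ≡ n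
  vertices = trans (family-order k L) (m+[n∸m]≡n 2k+2≤n)
... | no 2k+2≰n = subst₂ (NonIsomorphicSimpleKPaths k) (m+[n∸m]≡n k<n) (cong (k ^_) (sym no-free-moves))
                         (someSimpleKPath k (n ∸ suc k) (<⇒≤ 2≤k))
  where
  k<n : k < n
  k<n = <-≤-trans (m<m+n k (s≤s z≤n)) k+4≤n
  no-free-moves : n ∸ (2 * k + 2) ≡ 0
  no-free-moves = m≤n⇒m∸n≡0 (<⇒≤ (≰⇒> 2k+2≰n))
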